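{- Let $I,J\subseteq S$ and $w\in W$ with $w^{ -1}Iw=J$, and suppose $w$ is the minimal-length element of $W_Iw=wW_J$. Let $P_I=BW_IB$ and $P_J=BW_JB$. Then $|P_I|=|P_J|$ and $|P_IwP_J|=Q(w)\,|P_I|$.
   Context: $G$ is a finite group of Lie type over $\mathbb{F}_q$ with $BN$-pair $(B,N)$, Weyl group $W$, simple reflections $S$, and $W_I=\langle I\rangle$ for $I\subseteq S$. For $s\in S$ let $Q(s)=|BsB|/|B|$ (the thickness parameter, constant on conjugacy classes of simple reflections), and for $w\in W$ let $Q(w)=\prod_{s\in S}Q(s)^{m_s(w)}$, where $m_s(w)$ is the number of occurrences of $s$ in a reduced expression of $w$; then $|BwB|=Q(w)|B|$. -}

module Defs where

open import Level using (0ℓ)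
open import Data.Bool using (Bool; true; false; _∧_; _∨_; T)
open import Data.Nat using (ℕ; s≤s; z≤n; zero; suc; _*_; _≤_; _<_; NonZero; >-nonZero)
open import Data.Nat.Properties using (≤-trans; n≤1+n)
open import Data.Nat.DivMod using (_/_)
open import Data.List using (List; []; _∷_; length; filterᵇ; foldr)
open import Data.Bool.ListAction using (any)
open import Data.List.Membership.Propositional using (_∈_)
open import Data.List.Relation.Unary.Any using (here; there)
open import Data.List.Relation.Unary.All using (All)
open import Data.List.Relation.Unary.Unique.Propositional using (Unique)
open import Data.Product using (proj₁; Σ; _×_; _,_; ∃; ∃-syntax)
open import Data.Sum using (_⊎_)
open import Relation.Nullary using (¬_; ⌊_⌋)
open import Relation.Binary.PropositionalEquality using (_≡_; refl; subst)
open import Relation.Binary.Definitions using (DecidableEquality)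
open import Algebra.Structures using (IsGroup)
open import Function.Bundles using (_⇔_)

-- Finite groups (equality is propositional; elements enumerated
-- without repetition, so counting gives the order of a subset)

record FiniteGroup : Set₁ where
  infixl 7 _∙_
  field
    Carrier  : Set
    _≟_      : DecidableEquality Carrier
    elems    : List Carrier
    complete : ∀ x → x ∈ elems
    unique   : Unique elems
    _∙_      : Carrier → Carrier → Carrier
    ε        : Carrier
    _⁻¹      : Carrier → Carrier
    isGroup  : IsGroup _≡_ _∙_ ε _⁻¹

  Subset : Set
  Subset = Carrier → Bool

  ∣_∣ : Subset → ℕ
  ∣ P ∣ = length (filterᵇ P elems)

  prod : List Carrier → Carrier
  prod = foldr _∙_ ε

  IsSubgroup : Subset → Set
  IsSubgroup H = T (H ε)
               × (∀ x y → T (H x) → T (H y) → T (H (x ∙ y)))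
               × (∀ x → T (H x) → T (H (x ⁻¹)))

  IsWord : Subset → List Carrier → Carrier → Set
  IsWord X ws w = All (λ s → T (X s)) ws × prod ws ≡ w

  -- lengths with respect to the generating set X:  ℓ(w) ≤ ℓ(v)
  LenLe : Subset → Carrier → Carrier → Set
  LenLe X w v = ∀ vs → IsWord X vs v → ∃[ ws ] (IsWord X ws w × length ws ≤ length vs)

  Reduced : Subset → List Carrier → Carrier → Set
  Reduced X ws w = IsWord X ws w × (∀ vs → IsWord X vs w → length ws ≤ length vs)

  -- ⟨X⟩ : elements expressible as products of at most k letters of X.
  -- (In a finite group, k = |G| words already give all of ⟨X⟩.)
  genUpTo : ℕ → Subset → Subset
  genUpTo zero    X w = ⌊ w ≟ ε ⌋
  genUpTo (suc k) X w = genUpTo k X w ∨ any (λ s → X s ∧ genUpTo k X (w ∙ s ⁻¹)) elems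

  ⟨_⟩ : Subset → Subset
  ⟨ X ⟩ = genUpTo (length elems) X

  _⊆_ : Subset → Subset → Set
  X ⊆ Y = ∀ x → T (X x) → T (Y x)



-- Finite groups with a BN-pair.  The Weyl group W = N/(B ∩ N) is given
-- as a finite group W together with a map π : G → W which restricts to
-- a surjective homomorphism N → W with kernel B ∩ N.

record BNPair (G : FiniteGroup) : Set₁ where
  open FiniteGroup G
  field
    B N  : Subset
    B-sub : IsSubgroup B
    N-sub : IsSubgroup N
    W    : FiniteGroup
    π    : Carrier → FiniteGroup.Carrier W
    S    : FiniteGroup.Subset W
  module W = FiniteGroup W
  field
    π-hom  : ∀ n m → T (N n) → T (N m) → π (n ∙ m) ≡ W._∙_ (π n) (π m)
    π-surj : ∀ w → ∃[ n ] (T (N n) × π n ≡ w)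
    π-ker  : ∀ n → T (N n) → (π n ≡ W.ε) ⇔ T (B n)
    gen-G  : ∀ g → ∃[ xs ] (All (λ x → T (B x ∨ N x)) xs × prod xs ≡ g)
    S-inv  : ∀ s → T (S s) → ¬ (s ≡ W.ε) × W._∙_ s s ≡ W.ε
    S-gen  : ∀ w → ∃[ ss ] W.IsWord S ss w

  -- the double coset B w B  (w ∈ W):  g = b n b' with n ∈ N, π n = w
  BwB : W.Carrier → Subset
  BwB w g = any (λ n → N n ∧ ⌊ π n W.≟ w ⌋ ∧
                 any (λ b → B b ∧ B ((n ⁻¹) ∙ (b ⁻¹) ∙ g)) elems) elems

  field
    BN-mult : ∀ s w → T (S s) → ∀ n m b → T (N n) → T (N m) → π n ≡ s → π m ≡ w → T (B b) →
              T (BwB w (n ∙ b ∙ m)) ⊎ T (BwB (W._∙_ s w) (n ∙ b ∙ m))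
    BN-ne   : ∀ s → T (S s) → ∀ n → T (N n) → π n ≡ s →
              ¬ (∀ g → B ((n ⁻¹) ∙ g ∙ n) ≡ B g)

  private
    filter-pos : ∀ (P : Subset) x xs → x ∈ xs → T (P x) → 0 < length (filterᵇ P xs)
    filter-pos P x (y ∷ ys) (here refl) px with P y
    ... | true = s≤s z≤n
    filter-pos P x (y ∷ ys) (there x∈) px with P y
    ... | true  = s≤s z≤n
    ... | false = filter-pos P x ys x∈ px

  instance
    ∣B∣-nonZero : NonZero ∣ B ∣
    ∣B∣-nonZero = >-nonZero (filter-pos B ε elems (complete ε) (proj₁ B-sub))

  Q : W.Carrier → ℕ
  Q s = ∣ BwB s ∣ / ∣ B ∣

  -- Q(w) computed along a word s₁ ⋯ sₖ: Q(s₁) ⋯ Q(sₖ)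
  Qword : List W.Carrier → ℕ
  Qword = foldr (λ s r → Q s * r) 1

  P : W.Subset → Subset
  P I g = any (λ w → W.⟨ I ⟩ w ∧ BwB w g) W.elems

  PwP : W.Subset → W.Carrier → W.Subset → Subset
  PwP I w J g = any (λ x → P I x ∧
                  any (λ n → N n ∧ ⌊ π n W.≟ w ⌋ ∧ P J ((n ⁻¹) ∙ (x ⁻¹) ∙ g)) elems) elems

{-# OPTIONS --safe #-}
-- The double coset P_I w P_J is the disjoint union of the Bruhat cells BxwB, x ∈ W_I: the
-- inclusion uses w W_J = W_I w and the multiplication rule sB · BvB ⊆ BvB ∪ BsvB.  Minimality of w
-- in W_I w turns the exchange condition into ℓ(xw) = ℓ(x) + ℓ(w) for x ∈ W_I, and cells multiply
-- as |BsB| |BvB| = |BsvB| |B| whenever ℓ(sv) > ℓ(v); hence |BxwB| = Q(w) |BxB|, and summing over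
-- W_I gives |P_I w P_J| = Q(w) |P_I|.  Inversion maps P_I w P_J onto P_J w⁻¹ P_I, and w⁻¹ is
-- minimal in W_J w⁻¹, so Q(w) |P_I| = Q(w⁻¹) |P_J| = Q(w) |P_J|.
module Submission where

open import Defs
open import Level using (0ℓ)
open import Algebra.Bundles using (Group)
import Algebra.Properties.Group as GroupProperties
open import Data.Bool using (Bool; true; false; T; _∧_; not)
open import Data.Bool.Properties using (T-∧; T-∨)
import Data.Bool.Properties as Bool
open import Data.Bool.ListAction using (any)
open import Data.Empty using (⊥; ⊥-elim)
open import Data.List using (List; []; _∷_; length; filterᵇ; map; reverse; _++_; [_])
open import Data.List.Properties
  using (length-++; length-++-sucʳ; length-reverse; unfold-reverse; reverse-map; ∷-injective; ++-assoc; foldr-map)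
open import Data.List.Membership.Propositional using (_∈_; find; lose)
open import Data.List.Relation.Binary.Permutation.Propositional using (↭-sym)
open import Data.List.Relation.Binary.Permutation.Propositional.Properties using (↭-reverse; All-resp-↭)
open import Data.List.Relation.Unary.All as All using (All; []; _∷_)
open import Data.List.Relation.Unary.All.Properties using (++⁺; ++⁻ˡ; ++⁻ʳ; map⁺; ¬All⇒Any¬)
open import Data.List.Relation.Unary.AllPairs using ([]; _∷_)
open import Data.List.Relation.Unary.Any using (here; there)
open import Data.List.Relation.Unary.Any.Properties using (any⁺; any⁻)
open import Data.List.Relation.Unary.Unique.Propositional using (Unique)
open import Data.Nat using (ℕ; zero; suc; _+_; _*_; _≤_; _<_; z≤n; s≤s; _≤?_; NonZero; >-nonZero)
open import Data.Nat.DivMod using (_/_; m*n/n≡m)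
open import Data.Nat.Divisibility using (_∣_; divides; ∣-refl; ∣m∣n⇒∣m+n)
open import Data.Nat.ListAction using (product)
open import Data.Nat.ListAction.Properties using (product-↭)
open import Data.Nat.Properties hiding (_≟_)
open import Data.Nat.Tactic.RingSolver using (solve-∀)
open import Data.Product using (_×_; _,_; proj₁; proj₂; ∃; ∃-syntax)
open import Data.Sum as Sum using (_⊎_; inj₁; inj₂)
open import Data.Unit using (tt)
open import Function using (_∘_; _⇔_; mk⇔; Equivalence)
open import Relation.Nullary using (¬_; yes; no; ⌊_⌋)
open import Relation.Nullary.Decidable using (toWitness; fromWitness; T?)
open import Relation.Binary.PropositionalEquality hiding ([_])
open import Tactic.MonoidSolver using (solve)

T-∧⁺ : ∀ {a b} → T a → T b → T (a ∧ b)
T-∧⁺ p q = Equivalence.from T-∧ (p , q)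

T-∧⁻ : ∀ a {b} → T (a ∧ b) → T a × T b
T-∧⁻ a = Equivalence.to T-∧

T-⇔⇒≡ : ∀ {a b} → (T a ⇔ T b) → a ≡ b
T-⇔⇒≡ {false} {false} _   = refl
T-⇔⇒≡ {true}  {true}  _   = refl
T-⇔⇒≡ {true}  {false} a⇔b = ⊥-elim (Equivalence.to a⇔b tt)
T-⇔⇒≡ {false} {true}  a⇔b = ⊥-elim (Equivalence.from a⇔b tt)

T-not⁺ : ∀ {a} → ¬ T a → T (not a)
T-not⁺ {false} _  = tt
T-not⁺ {true}  ¬a = ¬a tt

T-not⁻ : ∀ {a} → T (not a) → ¬ T a
T-not⁻ {false} _ ()

⟦_⟧ : Bool → ℕ
⟦ true  ⟧ = 1
⟦ false ⟧ = 0

⟦∧⟧ : ∀ a b → ⟦ a ∧ b ⟧ ≡ ⟦ a ⟧ * ⟦ b ⟧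
⟦∧⟧ true  b = sym (*-identityˡ ⟦ b ⟧)
⟦∧⟧ false b = refl

⟦⟧-split : ∀ a b → ⟦ a ⟧ ≡ ⟦ a ∧ b ⟧ + ⟦ a ∧ not b ⟧
⟦⟧-split true  true  = refl
⟦⟧-split true  false = refl
⟦⟧-split false b     = refl

⟦⟧-mono : ∀ {a b} → (T a → T b) → ⟦ a ⟧ ≤ ⟦ b ⟧
⟦⟧-mono {false}         _ = z≤n
⟦⟧-mono {true}  {true}  _ = ≤-refl
⟦⟧-mono {true}  {false} f = ⊥-elim (f tt)

∑ : {A : Set} → List A → (A → ℕ) → ℕ
∑ []       f = 0
∑ (x ∷ xs) f = f x + ∑ xs f

syntax ∑ xs (λ x → e) = ∑[ x ∈ xs ] e

private
  variable
    A A′ : Set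

∑-cong : ∀ (xs : List A) {f g : A → ℕ} → (∀ x → f x ≡ g x) → ∑ xs f ≡ ∑ xs g
∑-cong []       f≗g = refl
∑-cong (x ∷ xs) f≗g = cong₂ _+_ (f≗g x) (∑-cong xs f≗g)

∑-zero : ∀ (xs : List A) → ∑[ x ∈ xs ] 0 ≡ 0
∑-zero []       = refl
∑-zero (x ∷ xs) = ∑-zero xs

∑-distrib-+ : ∀ (xs : List A) (f g : A → ℕ) → ∑[ x ∈ xs ] (f x + g x) ≡ ∑ xs f + ∑ xs g
∑-distrib-+ []       f g = refl
∑-distrib-+ (x ∷ xs) f g = begin
  f x + g x + ∑[ x ∈ xs ] (f x + g x) ≡⟨ cong (f x + g x +_) (∑-distrib-+ xs f g) ⟩
  f x + g x + (∑ xs f + ∑ xs g)       ≡⟨ interchange (f x) (g x) (∑ xs f) (∑ xs g) ⟩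
  f x + ∑ xs f + (g x + ∑ xs g)       ∎
  where
  open ≡-Reasoning
  interchange : ∀ a b c d → a + b + (c + d) ≡ a + c + (b + d)
  interchange = solve-∀

∑-*ˡ : ∀ (xs : List A) c (f : A → ℕ) → ∑[ x ∈ xs ] (c * f x) ≡ c * ∑ xs f
∑-*ˡ []       c f = sym (*-zeroʳ c)
∑-*ˡ (x ∷ xs) c f = trans (cong (c * f x +_) (∑-*ˡ xs c f)) (sym (*-distribˡ-+ c (f x) (∑ xs f)))

∑-*ʳ : ∀ (xs : List A) c (f : A → ℕ) → ∑[ x ∈ xs ] (f x * c) ≡ ∑ xs f * c
∑-*ʳ xs c f = trans (∑-cong xs (λ x → *-comm (f x) c)) (trans (∑-*ˡ xs c f) (*-comm c (∑ xs f)))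

∑-comm : ∀ (xs : List A) (ys : List A′) (f : A → A′ → ℕ) →
         ∑[ x ∈ xs ] ∑[ y ∈ ys ] f x y ≡ ∑[ y ∈ ys ] ∑[ x ∈ xs ] f x y
∑-comm []       ys f = sym (∑-zero ys)
∑-comm (x ∷ xs) ys f = trans (cong (∑ ys (f x) +_) (∑-comm xs ys f))
                             (sym (∑-distrib-+ ys (f x) (λ y → ∑[ x ∈ xs ] f x y)))

∑-mono-≤ : ∀ (xs : List A) {f g : A → ℕ} → (∀ x → f x ≤ g x) → ∑ xs f ≤ ∑ xs g
∑-mono-≤ []       f≤g = z≤n
∑-mono-≤ (x ∷ xs) f≤g = +-mono-≤ (f≤g x) (∑-mono-≤ xs f≤g)

∑-mono-< : ∀ {xs : List A} {f g : A → ℕ} → (∀ x → f x ≤ g x) → ∀ {z} → z ∈ xs → f z < g z →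
           ∑ xs f < ∑ xs g
∑-mono-< {xs = x ∷ xs} f≤g (here refl) fz<gz = +-mono-<-≤ fz<gz (∑-mono-≤ xs f≤g)
∑-mono-< {xs = x ∷ xs} f≤g (there z∈) fz<gz = +-mono-≤-< (f≤g x) (∑-mono-< f≤g z∈ fz<gz)

≤-∑ : ∀ {xs : List A} (f : A → ℕ) {z} → z ∈ xs → f z ≤ ∑ xs f
≤-∑ {xs = x ∷ xs} f (here refl) = m≤m+n (f x) (∑ xs f)
≤-∑ {xs = x ∷ xs} f (there z∈)  = ≤-trans (≤-∑ f z∈) (m≤n+m (∑ xs f) (f x))

∑⟦⟧≤length : ∀ (xs : List A) (p : A → Bool) → ∑[ x ∈ xs ] ⟦ p x ⟧ ≤ length xs
∑⟦⟧≤length []       p = z≤n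
∑⟦⟧≤length (x ∷ xs) p = +-mono-≤ (⟦⟧-mono {b = true} _) (∑⟦⟧≤length xs p)

length-filterᵇ : ∀ (p : A → Bool) xs → length (filterᵇ p xs) ≡ ∑[ x ∈ xs ] ⟦ p x ⟧
length-filterᵇ p []       = refl
length-filterᵇ p (x ∷ xs) with p x
... | true  = cong suc (length-filterᵇ p xs)
... | false = length-filterᵇ p xs

∑⟦⟧-pos⇒∃ : ∀ (xs : List A) (p : A → Bool) → 0 < ∑[ x ∈ xs ] ⟦ p x ⟧ → ∃[ x ] T (p x)
∑⟦⟧-pos⇒∃ (x ∷ xs) p pos with p x in px
... | true  = x , subst T (sym px) tt
... | false = ∑⟦⟧-pos⇒∃ xs p pos

∑⟦⟧-none : ∀ (xs : List A) (p : A → Bool) → All (λ x → ¬ T (p x)) xs → ∑[ x ∈ xs ] ⟦ p x ⟧ ≡ 0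
∑⟦⟧-none []       p []           = refl
∑⟦⟧-none (x ∷ xs) p (¬px ∷ none) with p x
... | true  = ⊥-elim (¬px tt)
... | false = ∑⟦⟧-none xs p none

⟦any⟧≡∑ : ∀ {xs : List A} (p : A → Bool) → Unique xs → (∀ x y → T (p x) → T (p y) → x ≡ y) →
          ⟦ any p xs ⟧ ≡ ∑[ x ∈ xs ] ⟦ p x ⟧
⟦any⟧≡∑ {xs = []}     p []         disj = refl
⟦any⟧≡∑ {xs = x ∷ xs} p (x∉ ∷ uniq) disj with p x in px
... | false = ⟦any⟧≡∑ p uniq disj
... | true  = cong suc (sym (∑⟦⟧-none xs p (All.map absent x∉)))
  where
  absent : ∀ {y} → ¬ x ≡ y → ¬ T (p y)
  absent x≢y py = x≢y (disj x _ (subst T (sym px) tt) py)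

least-witness : ∀ (p : ℕ → Bool) n → T (p n) → ∃[ k ] (T (p k) × ∀ j → T (p j) → k ≤ j)
least-witness p n pn with p 0 in p0
... | true = 0 , subst T (sym p0) tt , λ _ _ → z≤n
least-witness p zero    pn | false = ⊥-elim (subst T p0 pn)
least-witness p (suc n) pn | false with least-witness (p ∘ suc) n pn
... | k , pk , least = suc k , pk , above
  where
  above : ∀ j → T (p j) → suc k ≤ j
  above zero    pj = ⊥-elim (subst T p0 pj)
  above (suc j) pj = s≤s (least j pj)

split-++ : ∀ (mid : List A) t post xs ys → mid ++ t ∷ post ≡ xs ++ ys →
           (∃[ p ] (xs ≡ mid ++ t ∷ p × post ≡ p ++ ys)) ⊎ (∃[ m ] (mid ≡ xs ++ m × ys ≡ m ++ t ∷ post))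
split-++ mid      t post []       ys eq   = inj₂ (mid , refl , sym eq)
split-++ []       t post (x ∷ xs) ys refl = inj₁ (xs , refl , refl)
split-++ (m ∷ mid) t post (x ∷ xs) ys eq with refl , eq′ ← ∷-injective eq with split-++ mid t post xs ys eq′
... | inj₁ (p , xs≡ , post≡) = inj₁ (p , cong (m ∷_) xs≡ , post≡)
... | inj₂ (m′ , mid≡ , ys≡) = inj₂ (m′ , cong (m ∷_) mid≡ , ys≡)

module FiniteGroupProperties (H : FiniteGroup) where
  open FiniteGroup H

  group : Group 0ℓ 0ℓ
  group = record { isGroup = isGroup }

  open Group group public using (assoc; identityˡ; identityʳ; inverseʳ; monoid)
  open GroupProperties group public
    using (⁻¹-involutive; ⁻¹-anti-homo-∙; ε⁻¹≈ε; ∙-cancelˡ; ∙-cancelʳ; inverseʳ-unique)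
    renaming ( \\-leftDividesˡ  to x∙[x⁻¹∙y]≡y; \\-leftDividesʳ  to x⁻¹∙[x∙y]≡y
             ; //-rightDividesˡ to y∙x⁻¹∙x≡y;   //-rightDividesʳ to y∙x∙x⁻¹≡y)

  x∙y∙[y⁻¹∙x⁻¹∙z]≡z : ∀ x y z → x ∙ y ∙ (y ⁻¹ ∙ x ⁻¹ ∙ z) ≡ z
  x∙y∙[y⁻¹∙x⁻¹∙z]≡z x y z =
    trans (cong (λ u → x ∙ y ∙ (u ∙ z)) (sym (⁻¹-anti-homo-∙ x y))) (x∙[x⁻¹∙y]≡y (x ∙ y) z)

  y⁻¹∙x⁻¹∙[x∙y∙z]≡z : ∀ x y z → y ⁻¹ ∙ x ⁻¹ ∙ (x ∙ y ∙ z) ≡ z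
  y⁻¹∙x⁻¹∙[x∙y∙z]≡z x y z =
    trans (cong (_∙ (x ∙ y ∙ z)) (sym (⁻¹-anti-homo-∙ x y))) (x⁻¹∙[x∙y]≡y (x ∙ y) z)

  prod-++ : ∀ xs ys → prod (xs ++ ys) ≡ prod xs ∙ prod ys
  prod-++ []       ys = sym (identityˡ (prod ys))
  prod-++ (x ∷ xs) ys = trans (cong (x ∙_) (prod-++ xs ys)) (sym (assoc x (prod xs) (prod ys)))

  prod-conj : ∀ a us → a ∙ prod us ≡ prod (map (λ t → a ∙ t ∙ a ⁻¹) us) ∙ a
  prod-conj a []       = trans (identityʳ a) (sym (identityˡ a))
  prod-conj a (t ∷ us) = begin
    a ∙ (t ∙ prod us)                          ≡⟨ assoc a t (prod us) ⟨
    a ∙ t ∙ prod us                            ≡⟨ cong (a ∙ t ∙_) (x⁻¹∙[x∙y]≡y a (prod us)) ⟨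
    a ∙ t ∙ (a ⁻¹ ∙ (a ∙ prod us))             ≡⟨ assoc (a ∙ t) (a ⁻¹) _ ⟨
    a ∙ t ∙ a ⁻¹ ∙ (a ∙ prod us)               ≡⟨ cong (a ∙ t ∙ a ⁻¹ ∙_) (prod-conj a us) ⟩
    a ∙ t ∙ a ⁻¹ ∙ (prod (map _ us) ∙ a)       ≡⟨ assoc (a ∙ t ∙ a ⁻¹) _ a ⟨
    a ∙ t ∙ a ⁻¹ ∙ prod (map _ us) ∙ a         ∎
    where open ≡-Reasoning

  Reduced-tail : ∀ {X s ss v} → Reduced X (s ∷ ss) v → Reduced X ss (prod ss)
  Reduced-tail {s = s} ((Xs ∷ Xss , refl) , minimal) =
    (Xss , refl) , λ vs (Xvs , vs≡) → ≤-pred (minimal (s ∷ vs) (Xs ∷ Xvs , cong (s ∙_) vs≡))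

  any-elems : ∀ (p : Carrier → Bool) → T (any p elems) ⇔ (∃[ x ] T (p x))
  any-elems p = mk⇔ (λ t → let x , _ , px = find (any⁻ p elems t) in x , px)
                    (λ (x , px) → any⁺ p (lose (complete x) px))

  _≐_ : Subset → Subset → Set
  X ≐ Y = ∀ g → T (X g) ⇔ T (Y g)

  ∣∣≡∑ : ∀ X → ∣ X ∣ ≡ ∑[ g ∈ elems ] ⟦ X g ⟧
  ∣∣≡∑ X = length-filterᵇ X elems

  ∣∣-cong : ∀ {X Y} → X ≐ Y → ∣ X ∣ ≡ ∣ Y ∣
  ∣∣-cong {X} {Y} X≐Y = begin
    ∣ X ∣                      ≡⟨ ∣∣≡∑ X ⟩
    ∑[ g ∈ elems ] ⟦ X g ⟧     ≡⟨ ∑-cong elems (λ g → cong ⟦_⟧ (T-⇔⇒≡ (X≐Y g))) ⟩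
    ∑[ g ∈ elems ] ⟦ Y g ⟧     ≡⟨ ∣∣≡∑ Y ⟨
    ∣ Y ∣                      ∎
    where open ≡-Reasoning

  ∣∣-empty : ∀ X → (∀ g → ¬ T (X g)) → ∣ X ∣ ≡ 0
  ∣∣-empty X empty = trans (∣∣≡∑ X) (∑⟦⟧-none elems X (All.tabulate (λ {g} _ → empty g)))

  ∣∣-pos : ∀ X {x} → T (X x) → 0 < ∣ X ∣
  ∣∣-pos X {x} Xx =
    subst (0 <_) (sym (∣∣≡∑ X)) (≤-trans (⟦⟧-mono {true} (λ _ → Xx)) (≤-∑ (λ g → ⟦ X g ⟧) (complete x)))

  ∣∣-pos⇒∃ : ∀ X → 0 < ∣ X ∣ → ∃[ x ] T (X x)
  ∣∣-pos⇒∃ X pos = ∑⟦⟧-pos⇒∃ elems X (subst (0 <_) (∣∣≡∑ X) pos)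

  ∣∣≤∣G∣ : ∀ X → ∣ X ∣ ≤ length elems
  ∣∣≤∣G∣ X = subst (_≤ length elems) (sym (∣∣≡∑ X)) (∑⟦⟧≤length elems X)

  ∣∣-mono-< : ∀ {X Y} → (∀ g → T (X g) → T (Y g)) → ∀ {y} → T (Y y) → ¬ T (X y) → ∣ X ∣ < ∣ Y ∣
  ∣∣-mono-< {X} {Y} X⊆Y {y} Yy ¬Xy = subst₂ _<_ (sym (∣∣≡∑ X)) (sym (∣∣≡∑ Y))
    (∑-mono-< (λ g → ⟦⟧-mono (X⊆Y g)) (complete y) (strict (X y) (Y y) Yy ¬Xy))
    where
    strict : ∀ a b → T b → ¬ T a → ⟦ a ⟧ < ⟦ b ⟧
    strict false true _ _   = s≤s z≤n
    strict true  _    _ ¬a = ⊥-elim (¬a tt)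

  ∣∣-split : ∀ (X Y : Subset) → ∣ X ∣ ≡ ∣ (λ g → X g ∧ Y g) ∣ + ∣ (λ g → X g ∧ not (Y g)) ∣
  ∣∣-split X Y = begin
    ∣ X ∣                                                         ≡⟨ ∣∣≡∑ X ⟩
    ∑[ g ∈ elems ] ⟦ X g ⟧                                        ≡⟨ ∑-cong elems (λ g → ⟦⟧-split (X g) (Y g)) ⟩
    ∑[ g ∈ elems ] (⟦ X g ∧ Y g ⟧ + ⟦ X g ∧ not (Y g) ⟧)          ≡⟨ ∑-distrib-+ elems _ _ ⟩
    (∑[ g ∈ elems ] ⟦ X g ∧ Y g ⟧) + (∑[ g ∈ elems ] ⟦ X g ∧ not (Y g) ⟧)
                                                                  ≡⟨ cong₂ _+_ (∣∣≡∑ _) (∣∣≡∑ _) ⟨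
    ∣ (λ g → X g ∧ Y g) ∣ + ∣ (λ g → X g ∧ not (Y g)) ∣           ∎
    where open ≡-Reasoning

  δ : Carrier → Carrier → ℕ
  δ x y = ⟦ ⌊ x ≟ y ⌋ ⟧

  ∑-δ : ∀ z (h : Carrier → ℕ) → ∑[ y ∈ elems ] (δ y z * h y) ≡ h z
  ∑-δ z h = begin
    ∑[ y ∈ elems ] (δ y z * h y)           ≡⟨ ∑-cong elems δ-subst ⟩
    ∑[ y ∈ elems ] (δ y z * h z)           ≡⟨ ∑-*ʳ elems (h z) (λ y → δ y z) ⟩
    (∑[ y ∈ elems ] δ y z) * h z           ≡⟨ cong (_* h z) (⟦any⟧≡∑ (λ y → ⌊ y ≟ z ⌋) unique both-z) ⟨
    ⟦ any (λ y → ⌊ y ≟ z ⌋) elems ⟧ * h z ≡⟨ cong (λ b → ⟦ b ⟧ * h z) (T-⇔⇒≡ (mk⇔ (λ _ → tt) (λ _ → z∈))) ⟩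
    1 * h z                                ≡⟨ *-identityˡ (h z) ⟩
    h z                                    ∎
    where
    open ≡-Reasoning
    δ-subst : ∀ y → δ y z * h y ≡ δ y z * h z
    δ-subst y with y ≟ z
    ... | yes refl = refl
    ... | no _     = refl
    both-z : ∀ x y → T ⌊ x ≟ z ⌋ → T ⌊ y ≟ z ⌋ → x ≡ y
    both-z x y x≡z y≡z = trans (toWitness x≡z) (sym (toWitness y≡z))
    z∈ : T (any (λ y → ⌊ y ≟ z ⌋) elems)
    z∈ = Equivalence.from (any-elems _) (z , fromWitness refl)

  ∑-bijection : ∀ (f f⁻ : Carrier → Carrier) → (∀ x → f⁻ (f x) ≡ x) → (∀ y → f (f⁻ y) ≡ y) →
                (h : Carrier → ℕ) → ∑[ x ∈ elems ] h (f x) ≡ ∑ elems h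
  ∑-bijection f f⁻ f⁻∘f f∘f⁻ h = begin
    ∑[ x ∈ elems ] h (f x)                              ≡⟨ ∑-cong elems (λ x → ∑-δ (f x) h) ⟨
    ∑[ x ∈ elems ] ∑[ y ∈ elems ] (δ y (f x) * h y)     ≡⟨ ∑-comm elems elems _ ⟩
    ∑[ y ∈ elems ] ∑[ x ∈ elems ] (δ y (f x) * h y)     ≡⟨ ∑-cong elems (λ y → ∑-cong elems (λ x → cong (_* h y) (δ-swap x y))) ⟩
    ∑[ y ∈ elems ] ∑[ x ∈ elems ] (δ x (f⁻ y) * h y)    ≡⟨ ∑-cong elems (λ y → ∑-δ (f⁻ y) (λ _ → h y)) ⟩
    ∑ elems h                                           ∎
    where
    open ≡-Reasoning
    δ-swap : ∀ x y → δ y (f x) ≡ δ x (f⁻ y)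
    δ-swap x y with y ≟ f x | x ≟ f⁻ y
    ... | yes _   | yes _   = refl
    ... | no _    | no _    = refl
    ... | yes y≡  | no x≢   = ⊥-elim (x≢ (trans (sym (f⁻∘f x)) (cong f⁻ (sym y≡))))
    ... | no y≢   | yes x≡  = ⊥-elim (y≢ (trans (sym (f∘f⁻ y)) (cong f (sym x≡))))

  ∣∣-translate : ∀ Y a → ∣ (λ g → Y (a ∙ g)) ∣ ≡ ∣ Y ∣
  ∣∣-translate Y a = begin
    ∣ (λ g → Y (a ∙ g)) ∣          ≡⟨ ∣∣≡∑ _ ⟩
    ∑[ g ∈ elems ] ⟦ Y (a ∙ g) ⟧   ≡⟨ ∑-bijection (a ∙_) (a ⁻¹ ∙_) (x⁻¹∙[x∙y]≡y a) (x∙[x⁻¹∙y]≡y a) (λ g → ⟦ Y g ⟧) ⟩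
    ∑[ g ∈ elems ] ⟦ Y g ⟧         ≡⟨ ∣∣≡∑ Y ⟨
    ∣ Y ∣                          ∎
    where open ≡-Reasoning

  ∣∣-invert : ∀ Y → ∣ (λ g → Y (g ⁻¹)) ∣ ≡ ∣ Y ∣
  ∣∣-invert Y = begin
    ∣ (λ g → Y (g ⁻¹)) ∣           ≡⟨ ∣∣≡∑ _ ⟩
    ∑[ g ∈ elems ] ⟦ Y (g ⁻¹) ⟧    ≡⟨ ∑-bijection _⁻¹ _⁻¹ ⁻¹-involutive ⁻¹-involutive (λ g → ⟦ Y g ⟧) ⟩
    ∑[ g ∈ elems ] ⟦ Y g ⟧         ≡⟨ ∣∣≡∑ Y ⟨
    ∣ Y ∣                          ∎
    where open ≡-Reasoning

  -- |X| |Y| counts the pairs (x, y), grouped by the product g = x y.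
  ∑-∣fibre∣ : ∀ (X Y : Subset) → ∑[ g ∈ elems ] ∣ (λ x → X x ∧ Y (x ⁻¹ ∙ g)) ∣ ≡ ∣ X ∣ * ∣ Y ∣
  ∑-∣fibre∣ X Y = begin
    ∑[ g ∈ elems ] ∣ (λ x → X x ∧ Y (x ⁻¹ ∙ g)) ∣
      ≡⟨ ∑-cong elems (λ g → trans (∣∣≡∑ _) (∑-cong elems (λ x → ⟦∧⟧ (X x) _))) ⟩
    ∑[ g ∈ elems ] ∑[ x ∈ elems ] (⟦ X x ⟧ * ⟦ Y (x ⁻¹ ∙ g) ⟧)
      ≡⟨ ∑-comm elems elems _ ⟩
    ∑[ x ∈ elems ] ∑[ g ∈ elems ] (⟦ X x ⟧ * ⟦ Y (x ⁻¹ ∙ g) ⟧)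
      ≡⟨ ∑-cong elems (λ x → ∑-*ˡ elems ⟦ X x ⟧ _) ⟩
    ∑[ x ∈ elems ] (⟦ X x ⟧ * ∑[ g ∈ elems ] ⟦ Y (x ⁻¹ ∙ g) ⟧)
      ≡⟨ ∑-cong elems (λ x → cong (⟦ X x ⟧ *_) (trans (sym (∣∣≡∑ _)) (∣∣-translate Y (x ⁻¹)))) ⟩
    ∑[ x ∈ elems ] (⟦ X x ⟧ * ∣ Y ∣)
      ≡⟨ ∑-*ʳ elems ∣ Y ∣ _ ⟩
    (∑[ x ∈ elems ] ⟦ X x ⟧) * ∣ Y ∣
      ≡⟨ cong (_* ∣ Y ∣) (∣∣≡∑ X) ⟨
    ∣ X ∣ * ∣ Y ∣ ∎
    where open ≡-Reasoning

  module _ (K : Subset) (K-sub : IsSubgroup K) where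
    private
      K-∙ = proj₁ (proj₂ K-sub)
      K-⁻¹ = proj₂ (proj₂ K-sub)

    RightInvariant : Subset → Set
    RightInvariant X = ∀ x k → T (X x) → T (K k) → T (X (x ∙ k))

    -- Peel off one coset xK ⊆ X at a time.
    ∣K∣∣∣X∣ : ∀ X → RightInvariant X → ∣ K ∣ ∣ ∣ X ∣
    ∣K∣∣∣X∣ X X-inv = go (∣ X ∣) X X-inv ≤-refl
      where
      go : ∀ n X → RightInvariant X → ∣ X ∣ ≤ n → ∣ K ∣ ∣ ∣ X ∣
      go n X X-inv ∣X∣≤n with ∣ X ∣ in ∣X∣≡
      ... | zero = divides 0 refl
      go (suc n) X X-inv ∣X∣≤n | suc c with ∣∣-pos⇒∃ X (subst (0 <_) (sym ∣X∣≡) (s≤s z≤n))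
      ... | x , Xx = subst (∣ K ∣ ∣_) (sym ∣X∣-split) (∣m∣n⇒∣m+n ∣-refl (go n X' X'-inv ∣X'∣≤n))
        where
        X' : Subset
        X' g = X g ∧ not (K (x ⁻¹ ∙ g))
        X'-inv : RightInvariant X'
        X'-inv g k X'g Kk = T-∧⁺ (X-inv g k Xg Kk) (T-not⁺ (λ K[x⁻¹gk] → T-not⁻ ¬K[x⁻¹g]
                                   (subst (T ∘ K) (trans (cong (_∙ k ⁻¹) (sym (assoc _ g k))) (y∙x∙x⁻¹≡y k _))
                                          (K-∙ _ _ K[x⁻¹gk] (K-⁻¹ k Kk)))))
          where
          Xg = proj₁ (T-∧⁻ (X g) X'g)
          ¬K[x⁻¹g] = proj₂ (T-∧⁻ (X g) X'g)
        ∣X∩xK∣≡∣K∣ : ∣ (λ g → X g ∧ K (x ⁻¹ ∙ g)) ∣ ≡ ∣ K ∣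
        ∣X∩xK∣≡∣K∣ = trans (∣∣-cong (λ g → mk⇔ (λ t → proj₂ (T-∧⁻ (X g) t))
                                                (λ t → T-∧⁺ (subst (T ∘ X) (x∙[x⁻¹∙y]≡y x g) (X-inv x _ Xx t)) t)))
                           (∣∣-translate K (x ⁻¹))
        ∣X∣-split : suc c ≡ ∣ K ∣ + ∣ X' ∣
        ∣X∣-split = trans (sym ∣X∣≡)
                          (trans (∣∣-split X (λ g → K (x ⁻¹ ∙ g))) (cong (_+ ∣ X' ∣) ∣X∩xK∣≡∣K∣))
        ∣X'∣≤n : ∣ X' ∣ ≤ n
        ∣X'∣≤n = ≤-pred (≤-trans (+-monoˡ-≤ ∣ X' ∣ (∣∣-pos K {ε} (proj₁ K-sub)))
                                 (subst (_≤ suc n) ∣X∣-split ∣X∣≤n))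

  module Generated (X : Subset) where

    gen : ℕ → Subset
    gen k = genUpTo k X

    gen-weaken : ∀ k → gen k ⊆ gen (suc k)
    gen-weaken k v t = Equivalence.from T-∨ (inj₁ t)

    gen-step : ∀ k v {s} → T (X s) → T (gen k (v ∙ s ⁻¹)) → T (gen (suc k) v)
    gen-step k v {s} Xs t = Equivalence.from T-∨ (inj₂ (Equivalence.from (any-elems _) (s , T-∧⁺ Xs t)))

    gen-suc⁻ : ∀ k v → T (gen (suc k) v) → T (gen k v) ⊎ ∃[ s ] (T (X s) × T (gen k (v ∙ s ⁻¹)))
    gen-suc⁻ k v t with Equivalence.to T-∨ t
    ... | inj₁ old = inj₁ old
    ... | inj₂ new = let s , p = Equivalence.to (any-elems _) new in inj₂ (s , T-∧⁻ (X s) p)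

    ε∈gen : ∀ k → T (gen k ε)
    ε∈gen zero    = fromWitness refl
    ε∈gen (suc k) = gen-weaken k ε (ε∈gen k)

    gen-mono : ∀ {j k} → j ≤ k → gen j ⊆ gen k
    gen-mono {k = zero}  z≤n       v t = t
    gen-mono {k = suc k} z≤n       v t = gen-weaken k v (gen-mono {k = k} z≤n v t)
    gen-mono {suc j} {suc k} (s≤s j≤k) v t with gen-suc⁻ j v t
    ... | inj₁ old             = gen-weaken k v (gen-mono j≤k v old)
    ... | inj₂ (s , Xs , rest) = gen-step k v Xs (gen-mono j≤k _ rest)

    gen-cons : ∀ k {s} v → T (X s) → T (gen k v) → T (gen (suc k) (s ∙ v))
    gen-cons zero {s} v Xs t with toWitness t
    ... | refl = gen-step zero (s ∙ ε) Xs (fromWitness (trans (cong (_∙ s ⁻¹) (identityʳ s)) (inverseʳ s)))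
    gen-cons (suc k) {s} v Xs t with gen-suc⁻ k v t
    ... | inj₁ old               = gen-weaken (suc k) (s ∙ v) (gen-cons k v Xs old)
    ... | inj₂ (s' , Xs' , rest) =
      gen-step (suc k) (s ∙ v) Xs' (subst (T ∘ gen (suc k)) (sym (assoc s v (s' ⁻¹))) (gen-cons k _ Xs rest))

    word⇒gen : ∀ {ws v} → IsWord X ws v → T (gen (length ws) v)
    word⇒gen {[]}     ([] , refl)       = ε∈gen zero
    word⇒gen {s ∷ ws} (Xs ∷ Xws , refl) = gen-cons (length ws) (prod ws) Xs (word⇒gen (Xws , refl))

    gen⇒word : ∀ k {v} → T (gen k v) → ∃[ ws ] (IsWord X ws v × length ws ≤ k)
    gen⇒word zero    t = [] , ([] , sym (toWitness t)) , z≤n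
    gen⇒word (suc k) {v} t with gen-suc⁻ k v t
    ... | inj₁ old = let ws , w , ≤k = gen⇒word k old in ws , w , m≤n⇒m≤1+n ≤k
    ... | inj₂ (s , Xs , rest) with gen⇒word k rest
    ...   | ws , (Xws , ws≡v∙s⁻¹) , ≤k = ws ++ [ s ] , (++⁺ Xws (Xs ∷ []) , prod-snoc) , length-snoc
      where
      prod-snoc : prod (ws ++ [ s ]) ≡ v
      prod-snoc = trans (prod-++ ws [ s ]) (trans (cong₂ _∙_ ws≡v∙s⁻¹ (identityʳ s)) (y∙x⁻¹∙x≡y s v))
      length-snoc : length (ws ++ [ s ]) ≤ suc k
      length-snoc = subst (_≤ suc k) (sym (trans (length-++ ws) (+-comm (length ws) 1))) (s≤s ≤k)

    Stable : ℕ → Set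
    Stable k = gen (suc k) ⊆ gen k

    stable⇒saturated : ∀ j → Stable j → ∀ m → gen m ⊆ gen j
    stable⇒saturated j st zero    v t = gen-mono {k = j} z≤n v t
    stable⇒saturated j st (suc m) v t with gen-suc⁻ m v t
    ... | inj₁ old             = stable⇒saturated j st m v old
    ... | inj₂ (s , Xs , rest) = st v (gen-step j v Xs (stable⇒saturated j st m _ rest))

    stable-or-growing : ∀ k → (∃[ j ] (j ≤ k × Stable j)) ⊎ (suc k ≤ ∣ gen k ∣)
    stable-or-growing zero = inj₂ (∣∣-pos (gen zero) (ε∈gen zero))
    stable-or-growing (suc k) with stable-or-growing k
    ... | inj₁ (j , j≤k , st) = inj₁ (j , m≤n⇒m≤1+n j≤k , st)
    ... | inj₂ growing with ∣ gen (suc k) ∣ ≤? ∣ gen k ∣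
    ...   | no  grows   = inj₂ (≤-trans (s≤s growing) (≰⇒> grows))
    ...   | yes stalled = inj₁ (k , n≤1+n k , stable)
      where
      stable : Stable k
      stable v t with T? (gen k v)
      ... | yes old = old
      ... | no  new = ⊥-elim (<⇒≱ (∣∣-mono-< (gen-weaken k) t new) stalled)

    -- Until gen k stabilises it gains an element at every step, so it is stable by k = |G|.
    gen⊆⟨⟩ : ∀ k → gen k ⊆ ⟨ X ⟩
    gen⊆⟨⟩ k v t with stable-or-growing (length elems)
    ... | inj₁ (j , j≤ , st) = gen-mono j≤ v (stable⇒saturated j st k v t)
    ... | inj₂ too-big       = ⊥-elim (<⇒≱ too-big (∣∣≤∣G∣ _))

    word⇒⟨⟩ : ∀ {ws v} → IsWord X ws v → T (⟨ X ⟩ v)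
    word⇒⟨⟩ {ws} {v} w = gen⊆⟨⟩ (length ws) v (word⇒gen w)

    ⟨⟩⇒word : ∀ {v} → T (⟨ X ⟩ v) → ∃[ ws ] IsWord X ws v
    ⟨⟩⇒word t = let ws , w , _ = gen⇒word (length elems) t in ws , w

    reduced-word : ∀ {ws v} → IsWord X ws v → ∃[ rs ] Reduced X rs v
    reduced-word {ws} {v} w =
      let k , gen-k , least = least-witness (λ k → gen k v) (length ws) (word⇒gen w)
          rs , rs-word , rs≤k = gen⇒word k gen-k
      in rs , rs-word , λ vs vs-word → ≤-trans rs≤k (least (length vs) (word⇒gen vs-word))

    ε∈⟨⟩ : T (⟨ X ⟩ ε)
    ε∈⟨⟩ = ε∈gen (length elems)

    generator∈⟨⟩ : ∀ {s} → T (X s) → T (⟨ X ⟩ s)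
    generator∈⟨⟩ {s} Xs = word⇒⟨⟩ {[ s ]} (Xs ∷ [] , identityʳ s)

    ⟨⟩-∙ : ∀ {u v} → T (⟨ X ⟩ u) → T (⟨ X ⟩ v) → T (⟨ X ⟩ (u ∙ v))
    ⟨⟩-∙ u∈ v∈ with ⟨⟩⇒word u∈ | ⟨⟩⇒word v∈
    ... | us , (Xus , refl) | vs , (Xvs , refl) = word⇒⟨⟩ (++⁺ Xus Xvs , prod-++ us vs)

  ⟨⟩-conj : ∀ {X Y} a → (∀ t → T (Y t) → T (X (a ∙ t ∙ a ⁻¹))) →
            ∀ {y} → T (⟨ Y ⟩ y) → T (⟨ X ⟩ (a ∙ y ∙ a ⁻¹))
  ⟨⟩-conj {X} {Y} a Y⇒X y∈ with Generated.⟨⟩⇒word Y y∈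
  ... | ys , (Yys , refl) = Generated.word⇒⟨⟩ X (map⁺ (All.map (λ {t} → Y⇒X t) Yys) , conj-prod)
    where
    conj-prod : prod (map (λ t → a ∙ t ∙ a ⁻¹) ys) ≡ a ∙ prod ys ∙ a ⁻¹
    conj-prod = trans (sym (y∙x∙x⁻¹≡y a _)) (cong (_∙ a ⁻¹) (sym (prod-conj a ys)))

-- Length with respect to a generating set of involutions

module WordLength (H : FiniteGroup) (S : FiniteGroup.Subset H)
  (S-invol : ∀ s → T (S s) → ¬ s ≡ FiniteGroup.ε H × FiniteGroup._∙_ H s s ≡ FiniteGroup.ε H)
  (S-gen : ∀ w → ∃[ ss ] FiniteGroup.IsWord H S ss w) where

  open FiniteGroup H
  open FiniteGroupProperties H
  open Generated S using (reduced-word)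

  Letters : List Carrier → Set
  Letters = All (T ∘ S)

  module _ {s} (Ss : T (S s)) where

    s≢ε : ¬ s ≡ ε
    s≢ε = proj₁ (S-invol s Ss)

    s∙s≡ε : s ∙ s ≡ ε
    s∙s≡ε = proj₂ (S-invol s Ss)

    s⁻¹≡s : s ⁻¹ ≡ s
    s⁻¹≡s = sym (inverseʳ-unique s s s∙s≡ε)

    s∙[s∙v]≡v : ∀ v → s ∙ (s ∙ v) ≡ v
    s∙[s∙v]≡v v = trans (sym (assoc s s v)) (trans (cong (_∙ v) s∙s≡ε) (identityˡ v))

  prod-reverse : ∀ {ws} → Letters ws → prod (reverse ws) ≡ prod ws ⁻¹
  prod-reverse {[]}     []          = sym ε⁻¹≈ε
  prod-reverse {s ∷ ws} (Ss ∷ Sws) = begin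
    prod (reverse (s ∷ ws))       ≡⟨ cong prod (unfold-reverse s ws) ⟩
    prod (reverse ws ++ [ s ])    ≡⟨ prod-++ (reverse ws) [ s ] ⟩
    prod (reverse ws) ∙ (s ∙ ε)   ≡⟨ cong₂ _∙_ (prod-reverse Sws) (trans (identityʳ s) (sym (s⁻¹≡s Ss))) ⟩
    prod ws ⁻¹ ∙ s ⁻¹             ≡⟨ ⁻¹-anti-homo-∙ s (prod ws) ⟨
    (s ∙ prod ws) ⁻¹              ∎
    where open ≡-Reasoning

  reverse-word : ∀ {X ws w} → X ⊆ S → IsWord X ws w → IsWord X (reverse ws) (w ⁻¹)
  reverse-word {ws = ws} X⊆S (Xws , refl) =
    All-resp-↭ (↭-sym (↭-reverse ws)) Xws , prod-reverse (All.map (λ {x} → X⊆S x) Xws)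

  ⟨⟩-⁻¹ : ∀ {X v} → X ⊆ S → T (⟨ X ⟩ v) → T (⟨ X ⟩ (v ⁻¹))
  ⟨⟩-⁻¹ {X} X⊆S v∈ = Generated.word⇒⟨⟩ X (reverse-word X⊆S (proj₂ (Generated.⟨⟩⇒word X v∈)))

  exchange-deletes : ∀ {s t} mid post → T (S t) → s ∙ prod mid ≡ prod mid ∙ t →
                     s ∙ prod (mid ++ t ∷ post) ≡ prod (mid ++ post)
  exchange-deletes {s} {t} mid post St s∙mid≡mid∙t = begin
    s ∙ prod (mid ++ t ∷ post)           ≡⟨ cong (s ∙_) (prod-++ mid (t ∷ post)) ⟩
    s ∙ (prod mid ∙ (t ∙ prod post))     ≡⟨ assoc s (prod mid) _ ⟨
    s ∙ prod mid ∙ (t ∙ prod post)       ≡⟨ cong (_∙ (t ∙ prod post)) s∙mid≡mid∙t ⟩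
    prod mid ∙ t ∙ (t ∙ prod post)       ≡⟨ assoc (prod mid) t _ ⟩
    prod mid ∙ (t ∙ (t ∙ prod post))     ≡⟨ cong (prod mid ∙_) (s∙[s∙v]≡v St (prod post)) ⟩
    prod mid ∙ prod post                 ≡⟨ prod-++ mid post ⟨
    prod (mid ++ post)                   ∎
    where open ≡-Reasoning

  -- Proofs whose witnesses are consumed by later pattern matches are kept abstract throughout:
  -- otherwise Agda unfolds them while checking those matches, which makes type checking very slow.
  abstract
    ℓ-word : ∀ w → ∃[ rs ] Reduced S rs w
    ℓ-word w = reduced-word (proj₂ (S-gen w))

    ℓ : Carrier → ℕ
    ℓ w = length (proj₁ (ℓ-word w))

    ℓ-minimal : ∀ {ws w} → IsWord S ws w → ℓ w ≤ length ws
    ℓ-minimal {w = w} ws-word = proj₂ (proj₂ (ℓ-word w)) _ ws-word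

    Reduced⇒length≡ℓ : ∀ {ss w} → Reduced S ss w → length ss ≡ ℓ w
    Reduced⇒length≡ℓ {w = w} (ss-word , ss-minimal) =
      ≤-antisym (ss-minimal _ (proj₁ (proj₂ (ℓ-word w)))) (ℓ-minimal ss-word)

  length≡ℓ⇒Reduced : ∀ {ss w} → IsWord S ss w → length ss ≡ ℓ w → Reduced S ss w
  length≡ℓ⇒Reduced ss-word ss≡ℓ = ss-word , λ vs vs-word → subst (_≤ length vs) (sym ss≡ℓ) (ℓ-minimal vs-word)

  LenLe⇒ℓ≤ : ∀ {u v} → LenLe S u v → ℓ u ≤ ℓ v
  LenLe⇒ℓ≤ {v = v} u≤v with ℓ-word v
  ... | rs , rs-red@(rs-word , _) with u≤v rs rs-word
  ...   | ws , ws-word , ws≤rs = ≤-trans (ℓ-minimal ws-word) (subst (length ws ≤_) (Reduced⇒length≡ℓ rs-red) ws≤rs)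

  ℓ≡0⇒≡ε : ∀ {w} → ℓ w ≡ 0 → w ≡ ε
  ℓ≡0⇒≡ε {w} ℓw≡0 with ℓ-word w
  ... | rs , rs-red = empty-word rs-red (trans (Reduced⇒length≡ℓ rs-red) ℓw≡0)
    where
    empty-word : ∀ {rs} → Reduced S rs w → length rs ≡ 0 → w ≡ ε
    empty-word {[]} ((_ , ε≡w) , _) _ = sym ε≡w

  ℓ-ε : ℓ ε ≡ 0
  ℓ-ε = n≤0⇒n≡0 (ℓ-minimal ([] , refl))

  ℓ-letter : ∀ {s} → T (S s) → ℓ s ≡ 1
  ℓ-letter {s} Ss with ℓ s in ℓs | ℓ-minimal {[ s ]} (Ss ∷ [] , identityʳ s)
  ... | zero        | _       = ⊥-elim (s≢ε Ss (ℓ≡0⇒≡ε ℓs))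
  ... | suc zero    | _       = refl
  ... | suc (suc _) | s≤s ()

  ℓ-subadditive : ∀ u v → ℓ (u ∙ v) ≤ ℓ u + ℓ v
  ℓ-subadditive u v with ℓ-word u | ℓ-word v
  ... | us , us-red@((Sus , refl) , _) | vs , vs-red@((Svs , refl) , _) =
    subst (ℓ (prod us ∙ prod vs) ≤_)
          (trans (length-++ us) (cong₂ _+_ (Reduced⇒length≡ℓ us-red) (Reduced⇒length≡ℓ vs-red)))
          (ℓ-minimal (++⁺ Sus Svs , prod-++ us vs))

  ℓ-⁻¹ : ∀ v → ℓ (v ⁻¹) ≡ ℓ v
  ℓ-⁻¹ v = ≤-antisym (ℓ[v⁻¹]≤ℓ[v] v)
                     (subst (λ u → ℓ u ≤ ℓ (v ⁻¹)) (⁻¹-involutive v) (ℓ[v⁻¹]≤ℓ[v] (v ⁻¹)))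
    where
    ℓ[v⁻¹]≤ℓ[v] : ∀ v → ℓ (v ⁻¹) ≤ ℓ v
    ℓ[v⁻¹]≤ℓ[v] v with ℓ-word v
    ... | rs , rs-red@(rs-word , _) =
      subst (ℓ (v ⁻¹) ≤_) (trans (length-reverse rs) (Reduced⇒length≡ℓ rs-red))
            (ℓ-minimal (reverse-word (λ _ t → t) rs-word))

  module _ {s} (Ss : T (S s)) where

    ℓ[s∙v]≤1+ℓ[v] : ∀ v → ℓ (s ∙ v) ≤ suc (ℓ v)
    ℓ[s∙v]≤1+ℓ[v] v = subst (λ n → ℓ (s ∙ v) ≤ n + ℓ v) (ℓ-letter Ss) (ℓ-subadditive s v)

    ℓ[v∙s]≤1+ℓ[v] : ∀ v → ℓ (v ∙ s) ≤ suc (ℓ v)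
    ℓ[v∙s]≤1+ℓ[v] v = subst (λ n → ℓ (v ∙ s) ≤ n) (trans (cong (ℓ v +_) (ℓ-letter Ss)) (+-comm (ℓ v) 1))
                            (ℓ-subadditive v s)

    ℓ[v]≤1+ℓ[s∙v] : ∀ v → ℓ v ≤ suc (ℓ (s ∙ v))
    ℓ[v]≤1+ℓ[s∙v] v = subst (λ u → ℓ u ≤ suc (ℓ (s ∙ v))) (s∙[s∙v]≡v Ss v) (ℓ[s∙v]≤1+ℓ[v] (s ∙ v))

  abstract
    ℓ-cons : ∀ {v m} → ℓ v ≡ suc m → ∃[ s ] ∃[ u ] (T (S s) × v ≡ s ∙ u × ℓ u ≡ m)
    ℓ-cons {v} {m} ℓv≡1+m = let rs , rs-red = ℓ-word v in peel rs-red (trans (Reduced⇒length≡ℓ rs-red) ℓv≡1+m)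
      where
      peel : ∀ {rs} → Reduced S rs v → length rs ≡ suc m → ∃[ s ] ∃[ u ] (T (S s) × v ≡ s ∙ u × ℓ u ≡ m)
      peel {s ∷ rs} red@((Ss ∷ _ , s∙rs≡v) , _) len =
        s , prod rs , Ss , sym s∙rs≡v , trans (sym (Reduced⇒length≡ℓ (Reduced-tail red))) (suc-injective len)

    ℓ-snoc : ∀ {v m} → ℓ v ≡ suc m → ∃[ u ] ∃[ s ] (T (S s) × v ≡ u ∙ s × ℓ u ≡ m)
    ℓ-snoc {v} ℓv≡1+m with ℓ-cons (trans (ℓ-⁻¹ v) ℓv≡1+m)
    ... | s , u , Ss , v⁻¹≡s∙u , ℓu≡m = u ⁻¹ , s , Ss , v≡u⁻¹∙s , trans (ℓ-⁻¹ u) ℓu≡m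
      where
      v≡u⁻¹∙s : v ≡ u ⁻¹ ∙ s
      v≡u⁻¹∙s = begin
        v               ≡⟨ ⁻¹-involutive v ⟨
        v ⁻¹ ⁻¹         ≡⟨ cong _⁻¹ v⁻¹≡s∙u ⟩
        (s ∙ u) ⁻¹      ≡⟨ ⁻¹-anti-homo-∙ s u ⟩
        u ⁻¹ ∙ s ⁻¹     ≡⟨ cong (u ⁻¹ ∙_) (s⁻¹≡s Ss) ⟩
        u ⁻¹ ∙ s        ∎
        where open ≡-Reasoning

module BNPairProperties (G : FiniteGroup) (BN : BNPair G) where
  open FiniteGroup G
  open BNPair BN
  open FiniteGroupProperties G
  private module W′ = FiniteGroupProperties W
  open WordLength W S S-inv S-gen public

  infixl 7 _·_
  _·_ : W.Carrier → W.Carrier → W.Carrier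
  _·_ = W._∙_

  private
    B-ε : T (B ε)
    B-ε = proj₁ B-sub
    B-∙ : ∀ {x y} → T (B x) → T (B y) → T (B (x ∙ y))
    B-∙ = proj₁ (proj₂ B-sub) _ _
    B-⁻¹ : ∀ {x} → T (B x) → T (B (x ⁻¹))
    B-⁻¹ = proj₂ (proj₂ B-sub) _
    N-ε : T (N ε)
    N-ε = proj₁ N-sub
    N-∙ : ∀ {x y} → T (N x) → T (N y) → T (N (x ∙ y))
    N-∙ = proj₁ (proj₂ N-sub) _ _
    N-⁻¹ : ∀ {x} → T (N x) → T (N (x ⁻¹))
    N-⁻¹ = proj₂ (proj₂ N-sub) _

  π-ε : π ε ≡ W.ε
  π-ε = W′.∙-cancelʳ (π ε) (π ε) W.ε (begin
    π ε · π ε    ≡⟨ π-hom ε ε N-ε N-ε ⟨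
    π (ε ∙ ε)    ≡⟨ cong π (identityʳ ε) ⟩
    π ε          ≡⟨ W′.identityˡ (π ε) ⟨
    W.ε · π ε    ∎)
    where open ≡-Reasoning

  π-⁻¹ : ∀ {n} → T (N n) → π (n ⁻¹) ≡ π n W.⁻¹
  π-⁻¹ {n} Nn = W′.inverseʳ-unique (π n) (π (n ⁻¹))
                  (trans (sym (π-hom n (n ⁻¹) Nn (N-⁻¹ Nn))) (trans (cong π (inverseʳ n)) π-ε))

  -- Bruhat cells

  record InCell (v : W.Carrier) (g : Carrier) : Set where
    constructor cell
    field
      b n b'   : Carrier
      Bb       : T (B b)
      Nn       : T (N n)
      πn≡v     : π n ≡ v
      Bb'      : T (B b')
      g≡b∙n∙b' : g ≡ b ∙ n ∙ b'

  abstract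
    BwB⇒InCell : ∀ {v g} → T (BwB v g) → InCell v g
    BwB⇒InCell {v} {g} t =
      let n , t₁      = Equivalence.to (any-elems _) t
          Nn , t₂     = T-∧⁻ (N n) t₁
          πn≡v , t₃   = T-∧⁻ ⌊ π n W.≟ v ⌋ t₂
          b , t₄      = Equivalence.to (any-elems _) t₃
          Bb , Bb'    = T-∧⁻ (B b) t₄
      in cell b n (n ⁻¹ ∙ b ⁻¹ ∙ g) Bb Nn (toWitness πn≡v) Bb' (sym (x∙y∙[y⁻¹∙x⁻¹∙z]≡z b n g))

  InCell⇒BwB : ∀ {v g} → InCell v g → T (BwB v g)
  InCell⇒BwB (cell b n b' Bb Nn πn≡v Bb' refl) =
    Equivalence.from (any-elems _) (n , T-∧⁺ Nn (T-∧⁺ (fromWitness πn≡v)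
      (Equivalence.from (any-elems _) (b , T-∧⁺ Bb (subst (T ∘ B) (sym (y⁻¹∙x⁻¹∙[x∙y∙z]≡z b n b')) Bb')))))

  InCell-resp : ∀ {u v g} → u ≡ v → InCell u g → InCell v g
  InCell-resp refl c = c

  InCell-N : ∀ {v n} → T (N n) → π n ≡ v → InCell v n
  InCell-N {n = n} Nn πn≡v = cell ε n ε B-ε Nn πn≡v B-ε (sym (trans (identityʳ (ε ∙ n)) (identityˡ n)))

  B∙InCell : ∀ {v g c} → T (B c) → InCell v g → InCell v (c ∙ g)
  B∙InCell {c = c} Bc (cell b n b' Bb Nn πn≡v Bb' refl) =
    cell (c ∙ b) n b' (B-∙ Bc Bb) Nn πn≡v Bb' (solve monoid)

  InCell∙B : ∀ {v g c} → InCell v g → T (B c) → InCell v (g ∙ c)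
  InCell∙B {c = c} (cell b n b' Bb Nn πn≡v Bb' refl) Bc =
    cell b n (b' ∙ c) Bb Nn πn≡v (B-∙ Bb' Bc) (solve monoid)

  InCell-ε⇒B : ∀ {g} → InCell W.ε g → T (B g)
  InCell-ε⇒B (cell b n b' Bb Nn πn≡ε Bb' refl) =
    B-∙ (B-∙ Bb (Equivalence.to (π-ker n Nn) πn≡ε)) Bb'

  B⇒InCell-ε : ∀ {g} → T (B g) → InCell W.ε g
  B⇒InCell-ε {g} Bg = cell g ε ε Bg N-ε π-ε B-ε (sym (trans (identityʳ (g ∙ ε)) (identityʳ g)))

  InCell-⁻¹ : ∀ {v g} → InCell v g → InCell (v W.⁻¹) (g ⁻¹)
  InCell-⁻¹ (cell b n b' Bb Nn refl Bb' refl) =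
    cell (b' ⁻¹) (n ⁻¹) (b ⁻¹) (B-⁻¹ Bb') (N-⁻¹ Nn) (π-⁻¹ Nn) (B-⁻¹ Bb) (begin
      (b ∙ n ∙ b') ⁻¹            ≡⟨ ⁻¹-anti-homo-∙ (b ∙ n) b' ⟩
      b' ⁻¹ ∙ (b ∙ n) ⁻¹         ≡⟨ cong (b' ⁻¹ ∙_) (⁻¹-anti-homo-∙ b n) ⟩
      b' ⁻¹ ∙ (n ⁻¹ ∙ b ⁻¹)      ≡⟨ assoc (b' ⁻¹) (n ⁻¹) (b ⁻¹) ⟨
      b' ⁻¹ ∙ n ⁻¹ ∙ b ⁻¹        ∎)
    where open ≡-Reasoning

  InCell-letter⁻¹ : ∀ {s a} → T (S s) → InCell s a → InCell s (a ⁻¹)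
  InCell-letter⁻¹ Ss c = InCell-resp (s⁻¹≡s Ss) (InCell-⁻¹ c)

  abstract
    InCell-split : ∀ u v {g} → InCell (u · v) g → ∃[ a ] ∃[ y ] (InCell u a × InCell v y × g ≡ a ∙ y)
    InCell-split u v (cell b n b' Bb Nn πn≡uv Bb' refl) with π-surj u
    ... | m , Nm , πm≡u =
      b ∙ m , m ⁻¹ ∙ n ∙ b' ,
      B∙InCell Bb (InCell-N Nm πm≡u) ,
      InCell∙B (InCell-N (N-∙ (N-⁻¹ Nm) Nn) π[m⁻¹∙n]≡v) Bb' ,
      (begin
        b ∙ n ∙ b'                   ≡⟨ solve monoid ⟩
        b ∙ (n ∙ b')                 ≡⟨ cong (b ∙_) (x∙[x⁻¹∙y]≡y m (n ∙ b')) ⟨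
        b ∙ (m ∙ (m ⁻¹ ∙ (n ∙ b')))  ≡⟨ solve monoid ⟩
        b ∙ m ∙ (m ⁻¹ ∙ n ∙ b')      ∎)
      where
      open ≡-Reasoning
      π[m⁻¹∙n]≡v : π (m ⁻¹ ∙ n) ≡ v
      π[m⁻¹∙n]≡v = begin
        π (m ⁻¹ ∙ n)        ≡⟨ π-hom (m ⁻¹) n (N-⁻¹ Nm) Nn ⟩
        π (m ⁻¹) · π n      ≡⟨ cong₂ _·_ (trans (π-⁻¹ Nm) (cong W._⁻¹ πm≡u)) πn≡uv ⟩
        u W.⁻¹ · (u · v)    ≡⟨ W′.x⁻¹∙[x∙y]≡y u v ⟩
        v                   ∎

  InCell-s∙ : ∀ {s v a y} → T (S s) → InCell s a → InCell v y → InCell v (a ∙ y) ⊎ InCell (s · v) (a ∙ y)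
  InCell-s∙ {s} {v} Ss (cell b₁ n b₂ Bb₁ Nn πn≡s Bb₂ refl) (cell c₁ m c₂ Bc₁ Nm πm≡v Bc₂ refl) =
    Sum.map (surround ∘ BwB⇒InCell) (surround ∘ BwB⇒InCell)
            (BN-mult s v Ss n m (b₂ ∙ c₁) Nn Nm πn≡s πm≡v (B-∙ Bb₂ Bc₁))
    where
    surround : ∀ {u} → InCell u (n ∙ (b₂ ∙ c₁) ∙ m) → InCell u (b₁ ∙ n ∙ b₂ ∙ (c₁ ∙ m ∙ c₂))
    surround c = subst (InCell _) rearrange (InCell∙B (B∙InCell Bb₁ c) Bc₂)
      where
      rearrange : b₁ ∙ (n ∙ (b₂ ∙ c₁) ∙ m) ∙ c₂ ≡ b₁ ∙ n ∙ b₂ ∙ (c₁ ∙ m ∙ c₂)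
      rearrange = solve monoid

  InCell-∙s : ∀ {v s a y} → T (S s) → InCell v a → InCell s y → InCell v (a ∙ y) ⊎ InCell (v · s) (a ∙ y)
  InCell-∙s {v} {s} {a} {y} Ss ca cy =
    Sum.map (invert (W′.⁻¹-involutive v)) (invert v⁻¹·s-inverse)
            (InCell-s∙ Ss (InCell-letter⁻¹ Ss cy) (InCell-⁻¹ ca))
    where
    invert : ∀ {u u'} → u W.⁻¹ ≡ u' → InCell u (y ⁻¹ ∙ a ⁻¹) → InCell u' (a ∙ y)
    invert u⁻¹≡u' c = InCell-resp u⁻¹≡u'
      (subst (InCell _) (trans (cong _⁻¹ (sym (⁻¹-anti-homo-∙ a y))) (⁻¹-involutive (a ∙ y))) (InCell-⁻¹ c))
    v⁻¹·s-inverse : (s · v W.⁻¹) W.⁻¹ ≡ v · s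
    v⁻¹·s-inverse = trans (W′.⁻¹-anti-homo-∙ s (v W.⁻¹)) (cong₂ _·_ (W′.⁻¹-involutive v) (s⁻¹≡s Ss))

  B∩InCell⇒ε : ∀ {v g} → T (B g) → InCell v g → v ≡ W.ε
  B∩InCell⇒ε Bg (cell b n b' Bb Nn refl Bb' refl) =
    Equivalence.from (π-ker n Nn) (subst (T ∘ B) n≡ (B-∙ (B-∙ (B-⁻¹ Bb) Bg) (B-⁻¹ Bb')))
    where
    n≡ : b ⁻¹ ∙ (b ∙ n ∙ b') ∙ b' ⁻¹ ≡ n
    n≡ = trans (cong (_∙ b' ⁻¹) (trans (cong (b ⁻¹ ∙_) (assoc b n b')) (x⁻¹∙[x∙y]≡y b (n ∙ b'))))
               (y∙x∙x⁻¹≡y b' n)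

  -- Induction on ℓ v: for v = s u, the factor of g in BuB is a⁻¹g with a ∈ BsB, which the
  -- multiplication rule places in Bv'B or Bsv'B.
  InCell-unique-ℓ≤ : ∀ m {v v' g} → ℓ v ≡ m → ℓ v ≤ ℓ v' → InCell v g → InCell v' g → v ≡ v'
  InCell-unique-ℓ≤ zero ℓv≡0 _ c c' with refl ← ℓ≡0⇒≡ε ℓv≡0 = sym (B∩InCell⇒ε (InCell-ε⇒B c) c')
  InCell-unique-ℓ≤ (suc m) {v} {v'} ℓv≡1+m ℓv≤ℓv' c c' with ℓ-cons ℓv≡1+m
  ... | s , u , Ss , refl , ℓu≡m with InCell-split s u c
  ... | a , y , ca , cy , refl with InCell-s∙ Ss (InCell-letter⁻¹ Ss ca) c'
  ...   | inj₁ c'' = ⊥-elim (<-irrefl refl (begin-strict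
            ℓ v'      ≡⟨ cong ℓ (InCell-unique-ℓ≤ m ℓu≡m ℓu≤ℓv' cy (subst (InCell _) (x⁻¹∙[x∙y]≡y a y) c'')) ⟨
            ℓ u       ≡⟨ ℓu≡m ⟩
            m         <⟨ ≤-refl ⟩
            suc m     ≡⟨ ℓv≡1+m ⟨
            ℓ (s · u) ≤⟨ ℓv≤ℓv' ⟩
            ℓ v'      ∎))
    where
    open ≤-Reasoning
    ℓu≤ℓv' : ℓ u ≤ ℓ v'
    ℓu≤ℓv' = ≤-trans (≤-reflexive ℓu≡m) (≤-trans (n≤1+n m) (subst (_≤ ℓ v') ℓv≡1+m ℓv≤ℓv'))
  ...   | inj₂ c'' = trans (cong (s ·_) u≡s·v') (s∙[s∙v]≡v Ss v')
    where
    ℓu≤ℓ[s·v'] : ℓ u ≤ ℓ (s · v')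
    ℓu≤ℓ[s·v'] = subst (_≤ ℓ (s · v')) (sym ℓu≡m)
                   (≤-pred (≤-trans (subst (_≤ ℓ v') ℓv≡1+m ℓv≤ℓv') (ℓ[v]≤1+ℓ[s∙v] Ss v')))
    u≡s·v' : u ≡ s · v'
    u≡s·v' = InCell-unique-ℓ≤ m ℓu≡m ℓu≤ℓ[s·v'] cy (subst (InCell _) (x⁻¹∙[x∙y]≡y a y) c'')

  InCell-unique : ∀ {v v' g} → InCell v g → InCell v' g → v ≡ v'
  InCell-unique {v} {v'} c c' with ≤-total (ℓ v) (ℓ v')
  ... | inj₁ ℓv≤ℓv' = InCell-unique-ℓ≤ (ℓ v) refl ℓv≤ℓv' c c'
  ... | inj₂ ℓv'≤ℓv = sym (InCell-unique-ℓ≤ (ℓ v') refl ℓv'≤ℓv c' c)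

  -- Induction on ℓ v: for v = u t, the alternative a y ∈ BsuB of the multiplication rule would put
  -- y = a⁻¹(a y) in BsuB or BuB, i.e. v = s u or v = u.
  InCell-s∙-ascent-ℓ≡ : ∀ m {s v a y} → ℓ v ≡ m → T (S s) → ℓ v ≤ ℓ (s · v) →
                       InCell s a → InCell v y → InCell (s · v) (a ∙ y)
  InCell-s∙-ascent-ℓ≡ zero {s} ℓv≡0 Ss _ ca cy with refl ← ℓ≡0⇒≡ε ℓv≡0 =
    InCell-resp (sym (W′.identityʳ s)) (InCell∙B ca (InCell-ε⇒B cy))
  InCell-s∙-ascent-ℓ≡ (suc m) {s} {a = a} ℓv≡1+m Ss ascent ca cy with ℓ-snoc ℓv≡1+m
  ... | u , t , St , refl , ℓu≡m with InCell-split u t cy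
  ... | y₁ , y₂ , cy₁ , cy₂ , refl with InCell-∙s St (InCell-s∙-ascent-ℓ≡ m ℓu≡m Ss ℓu≤ℓ[s·u] ca cy₁) cy₂
    where
    ℓu≤ℓ[s·u] : ℓ u ≤ ℓ (s · u)
    ℓu≤ℓ[s·u] = subst (_≤ ℓ (s · u)) (sym ℓu≡m) (≤-pred (begin
      suc m              ≡⟨ ℓv≡1+m ⟨
      ℓ (u · t)          ≤⟨ ascent ⟩
      ℓ (s · (u · t))    ≡⟨ cong ℓ (W′.assoc s u t) ⟨
      ℓ (s · u · t)      ≤⟨ ℓ[v∙s]≤1+ℓ[v] St (s · u) ⟩
      suc (ℓ (s · u))    ∎))
      where open ≤-Reasoning
  ... | inj₂ c = InCell-resp (W′.assoc s u t) (subst (InCell _) (assoc a y₁ y₂) c)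
  ... | inj₁ c with InCell-s∙ Ss (InCell-letter⁻¹ Ss ca) (subst (InCell _) (assoc a y₁ y₂) c)
  ...   | inj₁ c' = ⊥-elim (<-irrefl refl (begin-strict
            ℓ (s · (u · t))   ≡⟨ cong (λ v → ℓ (s · v)) u·t≡s·u ⟩
            ℓ (s · (s · u))   ≡⟨ cong ℓ (s∙[s∙v]≡v Ss u) ⟩
            ℓ u               ≡⟨ ℓu≡m ⟩
            m                 <⟨ ≤-refl ⟩
            suc m             ≡⟨ ℓv≡1+m ⟨
            ℓ (u · t)         ≤⟨ ascent ⟩
            ℓ (s · (u · t))   ∎))
    where
    open ≤-Reasoning
    u·t≡s·u : u · t ≡ s · u
    u·t≡s·u = InCell-unique cy (subst (InCell _) (x⁻¹∙[x∙y]≡y a (y₁ ∙ y₂)) c')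
  ...   | inj₂ c' = ⊥-elim (s≢ε St (W′.∙-cancelˡ u t W.ε (trans u·t≡u (sym (W′.identityʳ u)))))
    where
    u·t≡u : u · t ≡ u
    u·t≡u = InCell-unique cy (InCell-resp (s∙[s∙v]≡v Ss u) (subst (InCell _) (x⁻¹∙[x∙y]≡y a (y₁ ∙ y₂)) c'))

  InCell-s∙-ascent : ∀ {s v a y} → T (S s) → ℓ v ≤ ℓ (s · v) → InCell s a → InCell v y → InCell (s · v) (a ∙ y)
  InCell-s∙-ascent {v = v} = InCell-s∙-ascent-ℓ≡ (ℓ v) refl

  -- For g ∈ BsvB, the pairs (x, x⁻¹g) ∈ BsB × BvB form the single coset x₀B.
  ∣fibre∣ : ∀ {s v} g → T (S s) → ℓ v ≤ ℓ (s · v) →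
            ∣ (λ x → BwB s x ∧ BwB v (x ⁻¹ ∙ g)) ∣ ≡ ⟦ BwB (s · v) g ⟧ * ∣ B ∣
  ∣fibre∣ {s} {v} g Ss ascent with BwB (s · v) g in g∈?
  ... | false = ∣∣-empty _ λ x t →
        let cx , cx⁻¹g = T-∧⁻ (BwB s x) t
        in subst T g∈? (InCell⇒BwB (subst (InCell _) (x∙[x⁻¹∙y]≡y x g)
             (InCell-s∙-ascent Ss ascent (BwB⇒InCell cx) (BwB⇒InCell cx⁻¹g))))
  ... | true with InCell-split s v (BwB⇒InCell (subst T (sym g∈?) tt))
  ... | x₀ , y₀ , cx₀ , cy₀ , refl =
        trans (∣∣-cong fibre≐x₀B) (trans (∣∣-translate B (x₀ ⁻¹)) (sym (*-identityˡ ∣ B ∣)))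
    where
    x⁻¹g≡ : ∀ x → (x₀ ⁻¹ ∙ x) ⁻¹ ∙ y₀ ≡ x ⁻¹ ∙ (x₀ ∙ y₀)
    x⁻¹g≡ x = begin
      (x₀ ⁻¹ ∙ x) ⁻¹ ∙ y₀         ≡⟨ cong (_∙ y₀) (⁻¹-anti-homo-∙ (x₀ ⁻¹) x) ⟩
      x ⁻¹ ∙ x₀ ⁻¹ ⁻¹ ∙ y₀        ≡⟨ cong (λ z → x ⁻¹ ∙ z ∙ y₀) (⁻¹-involutive x₀) ⟩
      x ⁻¹ ∙ x₀ ∙ y₀              ≡⟨ assoc (x ⁻¹) x₀ y₀ ⟩
      x ⁻¹ ∙ (x₀ ∙ y₀)            ∎
      where open ≡-Reasoning
    in-x₀B : ∀ x → T (BwB s x) → T (BwB v (x ⁻¹ ∙ (x₀ ∙ y₀))) → T (B (x₀ ⁻¹ ∙ x))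
    in-x₀B x cx cx⁻¹g with InCell-s∙ Ss (InCell-letter⁻¹ Ss cx₀) (BwB⇒InCell cx)
    ... | inj₂ c = InCell-ε⇒B (InCell-resp (s∙s≡ε Ss) c)
    ... | inj₁ c = ⊥-elim (s≢ε Ss (W′.∙-cancelʳ v s W.ε (trans s·v≡v (sym (W′.identityˡ v)))))
      where
      s·v≡v : s · v ≡ v
      s·v≡v = InCell-unique (subst (InCell _) (x⁻¹g≡ x) (InCell-s∙-ascent Ss ascent (InCell-letter⁻¹ Ss c) cy₀))
                            (BwB⇒InCell cx⁻¹g)
    fibre≐x₀B : (λ x → BwB s x ∧ BwB v (x ⁻¹ ∙ (x₀ ∙ y₀))) ≐ (λ x → B (x₀ ⁻¹ ∙ x))
    fibre≐x₀B x = mk⇔ (λ t → let cx , cx⁻¹g = T-∧⁻ (BwB s x) t in in-x₀B x cx cx⁻¹g)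
      (λ b → T-∧⁺ (InCell⇒BwB (subst (InCell s) (x∙[x⁻¹∙y]≡y x₀ x) (InCell∙B cx₀ b)))
                  (InCell⇒BwB (subst (InCell v) (x⁻¹g≡ x) (B∙InCell (B-⁻¹ b) cy₀))))

  ∣BsB∣*∣BvB∣ : ∀ {s v} → T (S s) → ℓ v ≤ ℓ (s · v) → ∣ BwB s ∣ * ∣ BwB v ∣ ≡ ∣ BwB (s · v) ∣ * ∣ B ∣
  ∣BsB∣*∣BvB∣ {s} {v} Ss ascent = begin
    ∣ BwB s ∣ * ∣ BwB v ∣                                     ≡⟨ ∑-∣fibre∣ (BwB s) (BwB v) ⟨
    ∑[ g ∈ elems ] ∣ (λ x → BwB s x ∧ BwB v (x ⁻¹ ∙ g)) ∣     ≡⟨ ∑-cong elems (λ g → ∣fibre∣ g Ss ascent) ⟩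
    ∑[ g ∈ elems ] (⟦ BwB (s · v) g ⟧ * ∣ B ∣)               ≡⟨ ∑-*ʳ elems ∣ B ∣ _ ⟩
    (∑[ g ∈ elems ] ⟦ BwB (s · v) g ⟧) * ∣ B ∣               ≡⟨ cong (_* ∣ B ∣) (∣∣≡∑ _) ⟨
    ∣ BwB (s · v) ∣ * ∣ B ∣                                   ∎
    where open ≡-Reasoning

  Q*∣B∣≡∣BwB∣ : ∀ v → Q v * ∣ B ∣ ≡ ∣ BwB v ∣
  Q*∣B∣≡∣BwB∣ v with ∣K∣∣∣X∣ B B-sub (BwB v) (λ x b t Bb → InCell⇒BwB (InCell∙B (BwB⇒InCell t) Bb))
  ... | divides q ∣BvB∣≡q*∣B∣ = trans (cong (λ n → n / ∣ B ∣ * ∣ B ∣) ∣BvB∣≡q*∣B∣)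
                                      (trans (cong (_* ∣ B ∣) (m*n/n≡m q ∣ B ∣)) (sym ∣BvB∣≡q*∣B∣))

  ∣BwB∣≡Qword*∣B∣ : ∀ {ss v} → W.Reduced S ss v → ∣ BwB v ∣ ≡ Qword ss * ∣ B ∣
  ∣BwB∣≡Qword*∣B∣ {[]} ((_ , refl) , _) =
    trans (∣∣-cong (λ g → mk⇔ (InCell-ε⇒B ∘ BwB⇒InCell) (InCell⇒BwB ∘ B⇒InCell-ε))) (sym (+-identityʳ ∣ B ∣))
  ∣BwB∣≡Qword*∣B∣ {s ∷ ss} red@((Ss ∷ _ , refl) , _) = *-cancelˡ-≡ _ _ ∣ B ∣ (begin
    ∣ B ∣ * ∣ BwB (s · W.prod ss) ∣              ≡⟨ *-comm ∣ B ∣ _ ⟩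
    ∣ BwB (s · W.prod ss) ∣ * ∣ B ∣              ≡⟨ ∣BsB∣*∣BvB∣ Ss ascent ⟨
    ∣ BwB s ∣ * ∣ BwB (W.prod ss) ∣             ≡⟨ cong₂ _*_ (sym (Q*∣B∣≡∣BwB∣ s)) (∣BwB∣≡Qword*∣B∣ tail) ⟩
    Q s * ∣ B ∣ * (Qword ss * ∣ B ∣)          ≡⟨ rearrange (Q s) (Qword ss) ∣ B ∣ ⟩
    ∣ B ∣ * (Q s * Qword ss * ∣ B ∣)          ∎)
    where
    open ≡-Reasoning
    tail = W′.Reduced-tail red
    ascent : ℓ (W.prod ss) ≤ ℓ (s · W.prod ss)
    ascent = subst₂ _≤_ (Reduced⇒length≡ℓ tail) (Reduced⇒length≡ℓ red) (n≤1+n (length ss))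
    rearrange : ∀ a b c → a * c * (b * c) ≡ c * (a * b * c)
    rearrange = solve-∀

  Qword-++ : ∀ xs ys → Qword (xs ++ ys) ≡ Qword xs * Qword ys
  Qword-++ []       ys = sym (+-identityʳ (Qword ys))
  Qword-++ (x ∷ xs) ys = trans (cong (Q x *_) (Qword-++ xs ys)) (sym (*-assoc (Q x) (Qword xs) (Qword ys)))

  Qword-reverse : ∀ ss → Qword (reverse ss) ≡ Qword ss
  Qword-reverse ss = begin
    Qword (reverse ss)             ≡⟨ foldr-map _*_ Q 1 (reverse ss) ⟨
    product (map Q (reverse ss))   ≡⟨ cong product (reverse-map Q ss) ⟩
    product (reverse (map Q ss))   ≡⟨ product-↭ (↭-reverse (map Q ss)) ⟩
    product (map Q ss)             ≡⟨ foldr-map _*_ Q 1 ss ⟩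
    Qword ss                       ∎
    where open ≡-Reasoning

  Q-nonZero : ∀ v → NonZero (Q v)
  Q-nonZero v with π-surj v
  ... | n , Nn , πn≡v = m*n≢0⇒m≢0 (Q v) {{>-nonZero (subst (0 <_) (sym (Q*∣B∣≡∣BwB∣ v)) ∣BvB∣>0)}}
    where
    ∣BvB∣>0 : 0 < ∣ BwB v ∣
    ∣BvB∣>0 = ∣∣-pos (BwB v) (InCell⇒BwB (InCell-N Nn πn≡v))

  Qword-nonZero : ∀ ss → NonZero (Qword ss)
  Qword-nonZero []       = _
  Qword-nonZero (s ∷ ss) = m*n≢0 (Q s) (Qword ss) {{Q-nonZero s}} {{Qword-nonZero ss}}

  -- The exchange condition

  B-moved-by-letter : ∀ {s} → T (S s) → ∃[ m ] ∃[ b ] (T (N m) × π m ≡ s × T (B b) × ¬ T (B (m ⁻¹ ∙ b ∙ m)))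
  B-moved-by-letter {s} Ss with π-surj s
  ... | n , Nn , πn≡s with All.all? (λ g → B (n ⁻¹ ∙ g ∙ n) Bool.≟ B g) elems
  ... | yes fixed = ⊥-elim (BN-ne s Ss n Nn πn≡s (λ g → All.lookup fixed (complete g)))
  ... | no moved with find (¬All⇒Any¬ (λ g → B (n ⁻¹ ∙ g ∙ n) Bool.≟ B g) elems moved)
  ... | g , _ , B[g]≢ with B g in Bg | B (n ⁻¹ ∙ g ∙ n) in Bgⁿ
  ... | true  | true  = ⊥-elim (B[g]≢ refl)
  ... | false | false = ⊥-elim (B[g]≢ refl)
  ... | true  | false = n , g , Nn , πn≡s , subst T (sym Bg) tt , subst T Bgⁿ
  ... | false | true  = n ⁻¹ , n ⁻¹ ∙ g ∙ n , N-⁻¹ Nn , π[n⁻¹]≡s , subst T (sym Bgⁿ) tt ,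
                        λ t → subst T Bg (subst (T ∘ B) conj-back t)
    where
    π[n⁻¹]≡s : π (n ⁻¹) ≡ s
    π[n⁻¹]≡s = trans (π-⁻¹ Nn) (trans (cong W._⁻¹ πn≡s) (s⁻¹≡s Ss))
    conj-back : n ⁻¹ ⁻¹ ∙ (n ⁻¹ ∙ g ∙ n) ∙ n ⁻¹ ≡ g
    conj-back = begin
      n ⁻¹ ⁻¹ ∙ (n ⁻¹ ∙ g ∙ n) ∙ n ⁻¹   ≡⟨ cong (λ x → x ∙ (n ⁻¹ ∙ g ∙ n) ∙ n ⁻¹) (⁻¹-involutive n) ⟩
      n ∙ (n ⁻¹ ∙ g ∙ n) ∙ n ⁻¹         ≡⟨ cong (λ x → n ∙ x ∙ n ⁻¹) (assoc (n ⁻¹) g n) ⟩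
      n ∙ (n ⁻¹ ∙ (g ∙ n)) ∙ n ⁻¹       ≡⟨ cong (_∙ n ⁻¹) (x∙[x⁻¹∙y]≡y n (g ∙ n)) ⟩
      g ∙ n ∙ n ⁻¹                      ≡⟨ y∙x∙x⁻¹≡y n g ⟩
      g                                 ∎
      where open ≡-Reasoning

  m⁻¹Bm∩BsB : ∀ {s} → T (S s) → ∃[ m ] ∃[ b ] (T (N m) × π m ≡ s × T (B b) × InCell s (m ⁻¹ ∙ b ∙ m))
  m⁻¹Bm∩BsB Ss with B-moved-by-letter Ss
  ... | m , b , Nm , πm≡s , Bb , moved
      with InCell-s∙ Ss (InCell-letter⁻¹ Ss (InCell-N Nm πm≡s)) (B∙InCell Bb (InCell-N Nm πm≡s))
  ... | inj₁ c = m , b , Nm , πm≡s , Bb , subst (InCell _) (sym (assoc (m ⁻¹) b m)) c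
  ... | inj₂ c = ⊥-elim (moved (subst (T ∘ B) (sym (assoc (m ⁻¹) b m)) (InCell-ε⇒B (InCell-resp (s∙s≡ε Ss) c))))

  -- For b ∈ B with m⁻¹bm ∈ BsB and π z = s u t, the element m⁻¹bmz lies in ButB, and splitting
  -- bmz ∈ ButB over u and t also puts it in BsuB or BsutB.
  exchange-step : ∀ {s u t} → T (S s) → T (S t) → ℓ u < ℓ (s · u) → ℓ (s · (u · t)) ≤ ℓ (u · t) → s · u ≡ u · t
  exchange-step {s} {u} {t} Ss St ascent descent with m⁻¹Bm∩BsB Ss | π-surj (s · (u · t))
  ... | m , b , Nm , πm≡s , Bb , c[m⁻¹bm] | z , Nz , πz≡s·ut
      with InCell-split u t (B∙InCell Bb (InCell-N (N-∙ Nm Nz) π[mz]≡ut))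
    where
    π[mz]≡ut : π (m ∙ z) ≡ u · t
    π[mz]≡ut = trans (π-hom m z Nm Nz) (trans (cong₂ _·_ πm≡s πz≡s·ut) (s∙[s∙v]≡v Ss (u · t)))
  ... | y₁ , y₂ , cy₁ , cy₂ , bmz≡y₁y₂ =
    conclude (InCell-∙s St (InCell-s∙-ascent Ss (<⇒≤ ascent) (InCell-letter⁻¹ Ss (InCell-N Nm πm≡s)) cy₁) cy₂)
    where
    g = m ⁻¹ ∙ b ∙ m ∙ z
    g∈B[ut]B : InCell (u · t) g
    g∈B[ut]B = InCell-resp (s∙[s∙v]≡v Ss (u · t)) (InCell-s∙-ascent Ss ascent′ c[m⁻¹bm] (InCell-N Nz πz≡s·ut))
      where
      ascent′ : ℓ (s · (u · t)) ≤ ℓ (s · (s · (u · t)))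
      ascent′ = subst (λ v → ℓ (s · (u · t)) ≤ ℓ v) (sym (s∙[s∙v]≡v Ss (u · t))) descent
    m⁻¹y₁y₂≡g : m ⁻¹ ∙ y₁ ∙ y₂ ≡ g
    m⁻¹y₁y₂≡g = begin
      m ⁻¹ ∙ y₁ ∙ y₂          ≡⟨ assoc (m ⁻¹) y₁ y₂ ⟩
      m ⁻¹ ∙ (y₁ ∙ y₂)        ≡⟨ cong (m ⁻¹ ∙_) bmz≡y₁y₂ ⟨
      m ⁻¹ ∙ (b ∙ (m ∙ z))    ≡⟨ solve monoid ⟩
      g                       ∎
      where open ≡-Reasoning
    conclude : InCell (s · u) (m ⁻¹ ∙ y₁ ∙ y₂) ⊎ InCell (s · u · t) (m ⁻¹ ∙ y₁ ∙ y₂) → s · u ≡ u · t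
    conclude (inj₁ c) = InCell-unique (subst (InCell _) m⁻¹y₁y₂≡g c) g∈B[ut]B
    conclude (inj₂ c) = ⊥-elim (s≢ε Ss (W′.∙-cancelʳ u s W.ε (trans s·u≡u (sym (W′.identityˡ u)))))
      where
      s·u≡u : s · u ≡ u
      s·u≡u = W′.∙-cancelʳ t (s · u) u (InCell-unique (subst (InCell _) m⁻¹y₁y₂≡g c) g∈B[ut]B)

  -- The first prefix u · prod mid of u · prod rest that s no longer lengthens gives the exchange.
  exchange : ∀ {s} u rest → T (S s) → Letters rest → ℓ u < ℓ (s · u) →
             ℓ (s · (u · W.prod rest)) ≤ ℓ (u · W.prod rest) →
             ∃[ mid ] ∃[ t ] ∃[ post ] (rest ≡ mid ++ t ∷ post × s · (u · W.prod mid) ≡ u · W.prod mid · t)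
  exchange {s} u [] Ss [] ascent descent =
    ⊥-elim (<⇒≱ ascent (subst (λ v → ℓ (s · v) ≤ ℓ v) (W′.identityʳ u) descent))
  exchange {s} u (t ∷ rest) Ss (St ∷ Srest) ascent descent with ℓ (s · (u · t)) ≤? ℓ (u · t)
  ... | yes descent′ = [] , t , rest , refl ,
        trans (cong (s ·_) (W′.identityʳ u)) (trans (exchange-step Ss St ascent descent′) (cong (_· t) (sym (W′.identityʳ u))))
  ... | no ascent′ with exchange (u · t) rest Ss Srest (≰⇒> ascent′)
                                 (subst (λ v → ℓ (s · v) ≤ ℓ v) (sym (W′.assoc u t (W.prod rest))) descent)
  ...   | mid , t′ , post , refl , exchanged = t ∷ mid , t′ , post , refl ,
          trans (cong (s ·_) (sym (W′.assoc u t (W.prod mid))))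
                (trans exchanged (cong (_· t′) (W′.assoc u t (W.prod mid))))

  exchange-condition : ∀ {s ws} → T (S s) → Letters ws → ℓ (s · W.prod ws) ≤ ℓ (W.prod ws) →
                       ∃[ mid ] ∃[ t ] ∃[ post ] (ws ≡ mid ++ t ∷ post × T (S t) ×
                                                  s · W.prod mid ≡ W.prod mid · t)
  exchange-condition {s} {ws} Ss Sws descent
    with exchange W.ε ws Ss Sws ℓε<ℓs (subst (λ v → ℓ (s · v) ≤ ℓ v) (sym (W′.identityˡ (W.prod ws))) descent)
    where
    ℓε<ℓs : ℓ W.ε < ℓ (s · W.ε)
    ℓε<ℓs = subst₂ _<_ (sym ℓ-ε) (trans (sym (ℓ-letter Ss)) (cong ℓ (sym (W′.identityʳ s)))) (s≤s z≤n)
  ... | mid , t , post , refl , exchanged = mid , t , post , refl , St ,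
        trans (cong (s ·_) (sym (W′.identityˡ _))) (trans exchanged (cong (_· t) (W′.identityˡ _)))
    where
    St : T (S t)
    St = All.head (++⁻ʳ mid Sws)

  -- Parabolic subgroups

  abstract
    P⇒InCell : ∀ {K g} → T (P K g) → ∃[ x ] (T (W.⟨ K ⟩ x) × InCell x g)
    P⇒InCell {K} t = let x , t′ = Equivalence.to (W′.any-elems _) t
                         x∈ , c = T-∧⁻ (W.⟨ K ⟩ x) t′
                     in x , x∈ , BwB⇒InCell c

  InCell⇒P : ∀ {K x g} → T (W.⟨ K ⟩ x) → InCell x g → T (P K g)
  InCell⇒P x∈ c = Equivalence.from (W′.any-elems _) (_ , T-∧⁺ x∈ (InCell⇒BwB c))

  abstract
    PwP-elim : ∀ {I w J g} → T (PwP I w J g) →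
               ∃[ p ] ∃[ n ] ∃[ q ] (T (P I p) × T (N n) × π n ≡ w × T (P J q) × g ≡ p ∙ n ∙ q)
    PwP-elim {I} {w} {J} {g} t =
      let p , t₁     = Equivalence.to (any-elems _) t
          Pp , t₂    = T-∧⁻ (P I p) t₁
          n , t₃     = Equivalence.to (any-elems _) t₂
          Nn , t₄    = T-∧⁻ (N n) t₃
          πn≡w , Pq  = T-∧⁻ ⌊ π n W.≟ w ⌋ t₄
      in p , n , n ⁻¹ ∙ p ⁻¹ ∙ g , Pp , Nn , toWitness πn≡w , Pq , sym (x∙y∙[y⁻¹∙x⁻¹∙z]≡z p n g)

  PwP-intro : ∀ {I w J p n q} → T (P I p) → T (N n) → π n ≡ w → T (P J q) → T (PwP I w J (p ∙ n ∙ q))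
  PwP-intro {J = J} {p} {n} {q} Pp Nn πn≡w Pq =
    Equivalence.from (any-elems _) (p , T-∧⁺ Pp (Equivalence.from (any-elems _) (n , T-∧⁺ Nn
      (T-∧⁺ (fromWitness πn≡w) (subst (T ∘ P J) (sym (y⁻¹∙x⁻¹∙[x∙y∙z]≡z p n q)) Pq)))))

  module _ {K : W.Subset} (K⊆S : K W.⊆ S) where
    private
      module K = W′.Generated K

    InCell-∙word : ∀ ts {v a y} → All (T ∘ K) ts → InCell v a → InCell (W.prod ts) y →
                   ∃[ us ] (All (T ∘ K) us × InCell (v · W.prod us) (a ∙ y))
    InCell-∙word [] {v} [] ca cy = [] , [] , InCell-resp (sym (W′.identityʳ v)) (InCell∙B ca (InCell-ε⇒B cy))
    InCell-∙word (t ∷ ts) {v} {a} (Kt ∷ Kts) ca cy with InCell-split t (W.prod ts) cy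
    ... | y₁ , y₂ , cy₁ , cy₂ , refl with InCell-∙s (K⊆S t Kt) ca cy₁
    ...   | inj₁ c = let us , Kus , c′ = InCell-∙word ts Kts c cy₂
                     in us , Kus , subst (InCell _) (assoc a y₁ y₂) c′
    ...   | inj₂ c = let us , Kus , c′ = InCell-∙word ts Kts c cy₂
                     in t ∷ us , Kt ∷ Kus , InCell-resp (W′.assoc v t _) (subst (InCell _) (assoc a y₁ y₂) c′)

    InCell-word∙ : ∀ ts {v a y} → All (T ∘ K) ts → InCell (W.prod ts) a → InCell v y →
                   ∃[ us ] (All (T ∘ K) us × InCell (W.prod us · v) (a ∙ y))
    InCell-word∙ [] {v} [] ca cy = [] , [] , InCell-resp (sym (W′.identityˡ v)) (B∙InCell (InCell-ε⇒B ca) cy)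
    InCell-word∙ (t ∷ ts) {v} {y = y} (Kt ∷ Kts) ca cy with InCell-split t (W.prod ts) ca
    ... | a₁ , a₂ , ca₁ , ca₂ , refl with InCell-word∙ ts Kts ca₂ cy
    ... | us , Kus , c with InCell-s∙ (K⊆S t Kt) ca₁ c
    ...   | inj₁ c′ = us , Kus , subst (InCell _) (sym (assoc a₁ a₂ y)) c′
    ...   | inj₂ c′ = t ∷ us , Kt ∷ Kus , InCell-resp (sym (W′.assoc t _ v)) (subst (InCell _) (sym (assoc a₁ a₂ y)) c′)

    InCell-∙⟨⟩ : ∀ {v u a y} → InCell v a → T (W.⟨ K ⟩ u) → InCell u y →
                 ∃[ u′ ] (T (W.⟨ K ⟩ u′) × InCell (v · u′) (a ∙ y))
    InCell-∙⟨⟩ ca u∈ cy with K.⟨⟩⇒word u∈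
    ... | ts , (Kts , refl) = let us , Kus , c = InCell-∙word ts Kts ca cy in W.prod us , K.word⇒⟨⟩ (Kus , refl) , c

    InCell-⟨⟩∙ : ∀ {u v a y} → T (W.⟨ K ⟩ u) → InCell u a → InCell v y →
                 ∃[ u′ ] (T (W.⟨ K ⟩ u′) × InCell (u′ · v) (a ∙ y))
    InCell-⟨⟩∙ u∈ ca cy with K.⟨⟩⇒word u∈
    ... | ts , (Kts , refl) = let us , Kus , c = InCell-word∙ ts Kts ca cy in W.prod us , K.word⇒⟨⟩ (Kus , refl) , c

    P-⁻¹ : ∀ {g} → T (P K g) → T (P K (g ⁻¹))
    P-⁻¹ t = let x , x∈ , c = P⇒InCell t in InCell⇒P (⟨⟩-⁻¹ K⊆S x∈) (InCell-⁻¹ c)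

  ∣PwP∣-⁻¹ : ∀ {I J} w → I W.⊆ S → J W.⊆ S → ∣ PwP I w J ∣ ≡ ∣ PwP J (w W.⁻¹) I ∣
  ∣PwP∣-⁻¹ {I} {J} w I⊆S J⊆S = trans (∣∣-cong (λ g → mk⇔ (invert I⊆S J⊆S) (back g))) (∣∣-invert _)
    where
    invert : ∀ {I J w g} → I W.⊆ S → J W.⊆ S → T (PwP I w J g) → T (PwP J (w W.⁻¹) I (g ⁻¹))
    invert I⊆S J⊆S t with PwP-elim t
    ... | p , n , q , Pp , Nn , refl , Pq , refl =
      subst (T ∘ PwP _ _ _) inverse (PwP-intro (P-⁻¹ J⊆S Pq) (N-⁻¹ Nn) (π-⁻¹ Nn) (P-⁻¹ I⊆S Pp))
      where
      inverse : q ⁻¹ ∙ n ⁻¹ ∙ p ⁻¹ ≡ (p ∙ n ∙ q) ⁻¹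
      inverse = sym (trans (⁻¹-anti-homo-∙ (p ∙ n) q) (trans (cong (q ⁻¹ ∙_) (⁻¹-anti-homo-∙ p n)) (sym (assoc _ _ _))))
    back : ∀ g → T (PwP J (w W.⁻¹) I (g ⁻¹)) → T (PwP I w J g)
    back g t = subst₂ (λ v h → T (PwP I v J h)) (W′.⁻¹-involutive w) (⁻¹-involutive g) (invert J⊆S I⊆S t)

  ∣⋃BwB∣ : ∀ (C : W.Subset) (f : W.Carrier → W.Carrier) → (∀ x y → f x ≡ f y → x ≡ y) →
           ∣ (λ g → any (λ x → C x ∧ BwB (f x) g) W.elems) ∣ ≡ ∑[ x ∈ W.elems ] (⟦ C x ⟧ * ∣ BwB (f x) ∣)
  ∣⋃BwB∣ C f f-injective = begin
    ∣ (λ g → any (λ x → C x ∧ BwB (f x) g) W.elems) ∣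
      ≡⟨ ∣∣≡∑ _ ⟩
    ∑[ g ∈ elems ] ⟦ any (λ x → C x ∧ BwB (f x) g) W.elems ⟧
      ≡⟨ ∑-cong elems (λ g → ⟦any⟧≡∑ _ W.unique (disjoint g)) ⟩
    ∑[ g ∈ elems ] ∑[ x ∈ W.elems ] ⟦ C x ∧ BwB (f x) g ⟧
      ≡⟨ ∑-comm elems W.elems _ ⟩
    ∑[ x ∈ W.elems ] ∑[ g ∈ elems ] ⟦ C x ∧ BwB (f x) g ⟧
      ≡⟨ ∑-cong W.elems (λ x → trans (∑-cong elems (λ g → ⟦∧⟧ (C x) _)) (∑-*ˡ elems ⟦ C x ⟧ _)) ⟩
    ∑[ x ∈ W.elems ] (⟦ C x ⟧ * ∑[ g ∈ elems ] ⟦ BwB (f x) g ⟧)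
      ≡⟨ ∑-cong W.elems (λ x → cong (⟦ C x ⟧ *_) (∣∣≡∑ _)) ⟨
    ∑[ x ∈ W.elems ] (⟦ C x ⟧ * ∣ BwB (f x) ∣) ∎
    where
    open ≡-Reasoning
    disjoint : ∀ g x y → T (C x ∧ BwB (f x) g) → T (C y ∧ BwB (f y) g) → x ≡ y
    disjoint g x y tx ty = f-injective x y (InCell-unique (BwB⇒InCell (proj₂ (T-∧⁻ (C x) tx)))
                                                          (BwB⇒InCell (proj₂ (T-∧⁻ (C y) ty))))

  module Parabolic {I J : W.Subset} {w : W.Carrier} (I⊆S : I W.⊆ S) (J⊆S : J W.⊆ S)
                   (J≡w⁻¹Iw : ∀ t → J t ≡ I (w · t · w W.⁻¹)) where
    private
      module I = W′.Generated I
      module J = W′.Generated J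

    J⇒I : ∀ t → T (J t) → T (I (w · t · w W.⁻¹))
    J⇒I t = subst T (J≡w⁻¹Iw t)

    I≡wJw⁻¹ : ∀ s → I s ≡ J (w W.⁻¹ · s · w W.⁻¹ W.⁻¹)
    I≡wJw⁻¹ s = sym (trans (J≡w⁻¹Iw _) (cong I conj-back))
      where
      open ≡-Reasoning
      conj-back : w · (w W.⁻¹ · s · w W.⁻¹ W.⁻¹) · w W.⁻¹ ≡ s
      conj-back = begin
        w · (w W.⁻¹ · s · w W.⁻¹ W.⁻¹) · w W.⁻¹   ≡⟨ cong (λ v → w · (w W.⁻¹ · s · v) · w W.⁻¹) (W′.⁻¹-involutive w) ⟩
        w · (w W.⁻¹ · s · w) · w W.⁻¹              ≡⟨ cong (_· w W.⁻¹) (W′.assoc w _ w) ⟨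
        w · (w W.⁻¹ · s) · w · w W.⁻¹              ≡⟨ W′.y∙x∙x⁻¹≡y w _ ⟩
        w · (w W.⁻¹ · s)                           ≡⟨ W′.x∙[x⁻¹∙y]≡y w s ⟩
        s                                          ∎

    PwP⇒InCell : ∀ {g} → T (PwP I w J g) → ∃[ x ] (T (W.⟨ I ⟩ x) × InCell (x · w) g)
    PwP⇒InCell t with PwP-elim t
    ... | p , n , q , Pp , Nn , πn≡w , Pq , refl with P⇒InCell Pp | P⇒InCell Pq
    ... | x , x∈ , cp | y , y∈ , cq with InCell-∙⟨⟩ J⊆S (InCell-N Nn πn≡w) y∈ cq
    ... | u , u∈ , cnq with InCell-⟨⟩∙ I⊆S x∈ cp (InCell-resp (sym (W′.y∙x⁻¹∙x≡y w (w · u))) cnq)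
    ... | x′ , x′∈ , c =
      x′ · (w · u · w W.⁻¹) , I.⟨⟩-∙ x′∈ wuw⁻¹∈ ,
      InCell-resp (sym (W′.assoc x′ _ w)) (subst (InCell _) (sym (assoc p n q)) c)
      where
      wuw⁻¹∈ : T (W.⟨ I ⟩ (w · u · w W.⁻¹))
      wuw⁻¹∈ = W′.⟨⟩-conj w J⇒I u∈

    InCell⇒PwP : ∀ {x g} → T (W.⟨ I ⟩ x) → InCell (x · w) g → T (PwP I w J g)
    InCell⇒PwP {x} x∈ c with InCell-split x w c
    ... | a , _ , ca , cell b n b' Bb Nn πn≡w Bb' refl , refl =
      subst (T ∘ PwP I w J) rearrange
            (PwP-intro (InCell⇒P x∈ (InCell∙B ca Bb)) Nn πn≡w (InCell⇒P J.ε∈⟨⟩ (B⇒InCell-ε Bb')))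
      where
      rearrange : a ∙ b ∙ n ∙ b' ≡ a ∙ (b ∙ n ∙ b')
      rearrange = solve monoid

    ∣PwP∣≡∑ : ∣ PwP I w J ∣ ≡ ∑[ x ∈ W.elems ] (⟦ W.⟨ I ⟩ x ⟧ * ∣ BwB (x · w) ∣)
    ∣PwP∣≡∑ = trans (∣∣-cong PwP≐⋃) (∣⋃BwB∣ W.⟨ I ⟩ (_· w) (λ x y → W′.∙-cancelʳ w x y))
      where
      PwP≐⋃ : PwP I w J ≐ (λ g → any (λ x → W.⟨ I ⟩ x ∧ BwB (x · w) g) W.elems)
      PwP≐⋃ g = mk⇔
        (λ t → let x , x∈ , c = PwP⇒InCell t in Equivalence.from (W′.any-elems _) (x , T-∧⁺ x∈ (InCell⇒BwB c)))
        (λ t → let x , t′ = Equivalence.to (W′.any-elems _) t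
                   x∈ , c = T-∧⁻ (W.⟨ I ⟩ x) t′
               in InCell⇒PwP x∈ (BwB⇒InCell c))

    module Minimal (w-minimal : ∀ x → T (W.⟨ I ⟩ x) → ℓ w ≤ ℓ (x · w)) where

      w⁻¹-minimal : ∀ y → T (W.⟨ J ⟩ y) → ℓ (w W.⁻¹) ≤ ℓ (y · w W.⁻¹)
      w⁻¹-minimal y y∈ = begin
        ℓ (w W.⁻¹)                      ≡⟨ ℓ-⁻¹ w ⟩
        ℓ w                             ≤⟨ w-minimal x x∈ ⟩
        ℓ (x · w)                       ≡⟨ cong ℓ (W′.y∙x⁻¹∙x≡y w (w · y W.⁻¹)) ⟩
        ℓ (w · y W.⁻¹)                  ≡⟨ cong ℓ (cong (_· y W.⁻¹) (W′.⁻¹-involutive w)) ⟨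
        ℓ (w W.⁻¹ W.⁻¹ · y W.⁻¹)        ≡⟨ cong ℓ (W′.⁻¹-anti-homo-∙ y (w W.⁻¹)) ⟨
        ℓ ((y · w W.⁻¹) W.⁻¹)           ≡⟨ ℓ-⁻¹ (y · w W.⁻¹) ⟩
        ℓ (y · w W.⁻¹)                  ∎
        where
        open ≤-Reasoning
        x = w · y W.⁻¹ · w W.⁻¹
        x∈ : T (W.⟨ I ⟩ x)
        x∈ = W′.⟨⟩-conj w J⇒I (⟨⟩-⁻¹ J⊆S y∈)

      deletion-in-I-word : ∀ {s mid t p x} → W.Reduced I (s ∷ mid ++ t ∷ p) x → T (S t) →
                           s · W.prod mid ≡ W.prod mid · t → ⊥
      deletion-in-I-word {s} {mid} {t} {p} ((_ ∷ Ixs , refl) , I-minimal) St exchanged =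
        1+n≰n (≤-trans (n≤1+n _) (subst (λ n → suc n ≤ length (mid ++ p)) (length-++-sucʳ mid t p)
                                         (I-minimal (mid ++ p) shorter-word)))
        where
        shorter-word : W.IsWord I (mid ++ p) (s · W.prod (mid ++ t ∷ p))
        shorter-word = ++⁺ (++⁻ˡ mid Ixs) (All.tail (++⁻ʳ mid Ixs)) , sym (exchange-deletes mid p St exchanged)

      deletion-in-w : ∀ {s xs m t post} → T (I s) → All (T ∘ I) xs → T (S t) →
                      W.Reduced S (m ++ t ∷ post) w → s · W.prod (xs ++ m) ≡ W.prod (xs ++ m) · t → ⊥
      deletion-in-w {s} {xs} {m} {t} {post} Is Ixs St rw-red@((_ , rw≡w) , _) exchanged =
        <⇒≱ shorter (w-minimal y y∈)
        where
        x′ = W.prod xs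
        x′∈ : T (W.⟨ I ⟩ x′)
        x′∈ = I.word⇒⟨⟩ (Ixs , refl)
        y = x′ W.⁻¹ · s · x′
        y∈ : T (W.⟨ I ⟩ y)
        y∈ = I.⟨⟩-∙ (I.⟨⟩-∙ (⟨⟩-⁻¹ I⊆S x′∈) (I.generator∈⟨⟩ Is)) x′∈
        y·w≡ : y · w ≡ W.prod (m ++ post)
        y·w≡ = begin
          x′ W.⁻¹ · s · x′ · w                            ≡⟨ solve W′.monoid ⟩
          x′ W.⁻¹ · (s · (x′ · w))                        ≡⟨ cong (λ v → x′ W.⁻¹ · (s · (x′ · v))) rw≡w ⟨
          x′ W.⁻¹ · (s · (x′ · W.prod (m ++ t ∷ post)))   ≡⟨ cong (λ v → x′ W.⁻¹ · (s · v)) (W′.prod-++ xs _) ⟨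
          x′ W.⁻¹ · (s · W.prod (xs ++ m ++ t ∷ post))    ≡⟨ cong (λ ws → x′ W.⁻¹ · (s · W.prod ws)) (++-assoc xs m _) ⟨
          x′ W.⁻¹ · (s · W.prod ((xs ++ m) ++ t ∷ post))  ≡⟨ cong (x′ W.⁻¹ ·_) (exchange-deletes (xs ++ m) post St exchanged) ⟩
          x′ W.⁻¹ · W.prod ((xs ++ m) ++ post)            ≡⟨ cong (λ ws → x′ W.⁻¹ · W.prod ws) (++-assoc xs m post) ⟩
          x′ W.⁻¹ · W.prod (xs ++ m ++ post)              ≡⟨ cong (x′ W.⁻¹ ·_) (W′.prod-++ xs _) ⟩
          x′ W.⁻¹ · (x′ · W.prod (m ++ post))             ≡⟨ W′.x⁻¹∙[x∙y]≡y x′ _ ⟩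
          W.prod (m ++ post)                              ∎
          where open ≡-Reasoning
        shorter : ℓ (y · w) < ℓ w
        shorter = begin-strict
          ℓ (y · w)                   ≤⟨ ℓ-minimal (++⁺ (++⁻ˡ m Srw) (All.tail (++⁻ʳ m Srw)) , sym y·w≡) ⟩
          length (m ++ post)          <⟨ ≤-refl ⟩
          suc (length (m ++ post))    ≡⟨ length-++-sucʳ m t post ⟨
          length (m ++ t ∷ post)      ≡⟨ Reduced⇒length≡ℓ rw-red ⟩
          ℓ w                         ∎
          where
          open ≤-Reasoning
          Srw = proj₁ (proj₁ rw-red)

      -- The exchange condition would delete a letter either from the reduced I-word of x or from
      -- the reduced word of w; the latter yields y ∈ W_I with ℓ(yw) < ℓ(w).
      no-descent : ∀ {s xs x} → W.Reduced I (s ∷ xs) x → ¬ ℓ (s · (W.prod xs · w)) ≤ ℓ (W.prod xs · w)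
      no-descent {s} {xs} red@((Is ∷ Ixs , refl) , _) descent with ℓ-word w
      ... | rw , rw-red@((Srw , rw≡w) , _)
          with exchange-condition (I⊆S s Is) (++⁺ (All.map (λ {x} → I⊆S x) Ixs) Srw)
                 (subst (λ v → ℓ (s · v) ≤ ℓ v) (sym (trans (W′.prod-++ xs rw) (cong (W.prod xs ·_) rw≡w))) descent)
      ... | mid , t , post , xs++rw≡ , St , exchanged with split-++ mid t post xs rw (sym xs++rw≡)
      ...   | inj₁ (p , refl , refl) = deletion-in-I-word red St exchanged
      ...   | inj₂ (m , refl , refl) = deletion-in-w Is Ixs St rw-red exchanged

      ℓ-additive : ∀ {xs x} → W.Reduced I xs x → ℓ (x · w) ≡ length xs + ℓ w
      ℓ-additive {[]} ((_ , refl) , _) = cong ℓ (W′.identityˡ w)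
      ℓ-additive {s ∷ xs} red@((Is ∷ _ , refl) , _) with ℓ (s · (W.prod xs · w)) ≤? ℓ (W.prod xs · w)
      ... | yes descent = ⊥-elim (no-descent red descent)
      ... | no ascent = trans (cong ℓ (W′.assoc s (W.prod xs) w)) (≤-antisym upper lower)
        where
        ih : ℓ (W.prod xs · w) ≡ length xs + ℓ w
        ih = ℓ-additive (W′.Reduced-tail red)
        upper : ℓ (s · (W.prod xs · w)) ≤ suc (length xs + ℓ w)
        upper = subst (λ n → ℓ (s · (W.prod xs · w)) ≤ suc n) ih (ℓ[s∙v]≤1+ℓ[v] (I⊆S s Is) _)
        lower : suc (length xs + ℓ w) ≤ ℓ (s · (W.prod xs · w))
        lower = subst (λ n → suc n ≤ ℓ (s · (W.prod xs · w))) ih (≰⇒> ascent)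

      ∣BxwB∣ : ∀ {x ss} → T (W.⟨ I ⟩ x) → W.Reduced S ss w → ∣ BwB (x · w) ∣ ≡ Qword ss * ∣ BwB x ∣
      ∣BxwB∣ {x} {ss} x∈ ss-red@((Sss , ss≡w) , _) with I.reduced-word (proj₂ (I.⟨⟩⇒word x∈))
      ... | xs , xs-red@((Ixs , xs≡x) , _) = begin
        ∣ BwB (x · w) ∣                  ≡⟨ ∣BwB∣≡Qword*∣B∣ xs++ss-red ⟩
        Qword (xs ++ ss) * ∣ B ∣         ≡⟨ cong (_* ∣ B ∣) (Qword-++ xs ss) ⟩
        Qword xs * Qword ss * ∣ B ∣      ≡⟨ rearrange (Qword xs) (Qword ss) ∣ B ∣ ⟩
        Qword ss * (Qword xs * ∣ B ∣)    ≡⟨ cong (Qword ss *_) (∣BwB∣≡Qword*∣B∣ xs-S-red) ⟨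
        Qword ss * ∣ BwB x ∣             ∎
        where
        open ≡-Reasoning
        Sxs : Letters xs
        Sxs = All.map (λ {x} → I⊆S x) Ixs
        additive : ℓ (x · w) ≡ length xs + ℓ w
        additive = ℓ-additive xs-red
        xs-S-red : W.Reduced S xs x
        xs-S-red = length≡ℓ⇒Reduced (Sxs , xs≡x)
          (≤-antisym (+-cancelʳ-≤ (ℓ w) _ _ (subst (_≤ ℓ x + ℓ w) additive (ℓ-subadditive x w))) (ℓ-minimal (Sxs , xs≡x)))
        xs++ss-red : W.Reduced S (xs ++ ss) (x · w)
        xs++ss-red = length≡ℓ⇒Reduced (++⁺ Sxs Sss , trans (W′.prod-++ xs ss) (cong₂ _·_ xs≡x ss≡w))
          (trans (length-++ xs) (trans (cong (length xs +_) (Reduced⇒length≡ℓ ss-red)) (sym additive)))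
        rearrange : ∀ a b c → a * b * c ≡ b * (a * c)
        rearrange = solve-∀

      ∣PwP∣≡Qword*∣P∣ : ∀ ss → W.Reduced S ss w → ∣ PwP I w J ∣ ≡ Qword ss * ∣ P I ∣
      ∣PwP∣≡Qword*∣P∣ ss ss-red = begin
        ∣ PwP I w J ∣                                               ≡⟨ ∣PwP∣≡∑ ⟩
        ∑[ x ∈ W.elems ] (⟦ W.⟨ I ⟩ x ⟧ * ∣ BwB (x · w) ∣)          ≡⟨ ∑-cong W.elems term ⟩
        ∑[ x ∈ W.elems ] (Qword ss * (⟦ W.⟨ I ⟩ x ⟧ * ∣ BwB x ∣))   ≡⟨ ∑-*ˡ W.elems (Qword ss) _ ⟩
        Qword ss * ∑[ x ∈ W.elems ] (⟦ W.⟨ I ⟩ x ⟧ * ∣ BwB x ∣)     ≡⟨ cong (Qword ss *_) (∣⋃BwB∣ W.⟨ I ⟩ (λ x → x) (λ _ _ eq → eq)) ⟨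
        Qword ss * ∣ P I ∣                                          ∎
        where
        open ≡-Reasoning
        term : ∀ x → ⟦ W.⟨ I ⟩ x ⟧ * ∣ BwB (x · w) ∣ ≡ Qword ss * (⟦ W.⟨ I ⟩ x ⟧ * ∣ BwB x ∣)
        term x with W.⟨ I ⟩ x in x∈
        ... | false = sym (*-zeroʳ (Qword ss))
        ... | true  = trans (+-identityʳ _) (trans (∣BxwB∣ (subst T (sym x∈) tt) ss-red)
                                                   (cong (Qword ss *_) (sym (+-identityʳ _))))

  ∣Pᴵ∣≡∣Pᴶ∣ : ∀ {I J w} → I W.⊆ S → J W.⊆ S → (∀ t → J t ≡ I (w · t · w W.⁻¹)) →
            (∀ x → T (W.⟨ I ⟩ x) → ℓ w ≤ ℓ (x · w)) → ∣ P I ∣ ≡ ∣ P J ∣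
  ∣Pᴵ∣≡∣Pᴶ∣ {I} {J} {w} I⊆S J⊆S J≡w⁻¹Iw w-minimal with ℓ-word w
  ... | rs , rs-red@((Srs , rs≡w) , _) = *-cancelˡ-≡ ∣ P I ∣ ∣ P J ∣ (Qword rs) {{Qword-nonZero rs}} (begin
    Qword rs * ∣ P I ∣              ≡⟨ Forward.∣PwP∣≡Qword*∣P∣ rs rs-red ⟨
    ∣ PwP I w J ∣                   ≡⟨ ∣PwP∣-⁻¹ w I⊆S J⊆S ⟩
    ∣ PwP J (w W.⁻¹) I ∣            ≡⟨ Backward.∣PwP∣≡Qword*∣P∣ (reverse rs) reverse-red ⟩
    Qword (reverse rs) * ∣ P J ∣    ≡⟨ cong (_* ∣ P J ∣) (Qword-reverse rs) ⟩
    Qword rs * ∣ P J ∣              ∎)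
    where
    open ≡-Reasoning
    module Forward = Parabolic.Minimal I⊆S J⊆S J≡w⁻¹Iw w-minimal
    module Backward = Parabolic.Minimal J⊆S I⊆S (Parabolic.I≡wJw⁻¹ I⊆S J⊆S J≡w⁻¹Iw) Forward.w⁻¹-minimal
    reverse-red : W.Reduced S (reverse rs) (w W.⁻¹)
    reverse-red = length≡ℓ⇒Reduced (reverse-word (λ _ t → t) (Srs , rs≡w))
                    (trans (length-reverse rs) (trans (Reduced⇒length≡ℓ rs-red) (sym (ℓ-⁻¹ w))))

lemma3p6 : (G : FiniteGroup) (BN : BNPair G) →
    let open FiniteGroup G
        open BNPair BN
    in (I J : W.Subset) (w : W.Carrier) →
       I W.⊆ S → J W.⊆ S →
       (∀ s → J s ≡ I (w W.∙ s W.∙ (w W.⁻¹))) →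
       (∀ x → T (W.⟨ I ⟩ x) → W.LenLe S w (x W.∙ w)) →
       (∣ P I ∣ ≡ ∣ P J ∣) ×
       (∀ (ss : List W.Carrier) → W.Reduced S ss w →
          ∣ PwP I w J ∣ ≡ Qword ss * ∣ P I ∣)
lemma3p6 G BN I J w I⊆S J⊆S J≡w⁻¹Iw w-minimal =
  ∣Pᴵ∣≡∣Pᴶ∣ I⊆S J⊆S J≡w⁻¹Iw w-minimalℓ ,
  Parabolic.Minimal.∣PwP∣≡Qword*∣P∣ I⊆S J⊆S J≡w⁻¹Iw w-minimalℓ
  where
  open BNPair BN using (module W; S)
  open BNPairProperties G BN
  w-minimalℓ : ∀ x → T (W.⟨ I ⟩ x) → ℓ w ≤ ℓ (x · w)
  w-minimalℓ x x∈ = LenLe⇒ℓ≤ (w-minimal x x∈)
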